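{- Let $V_0,V_1,\dots$ be indeterminates and let $\boldsymbol{\lambda}=(\lambda_i)_{i\ge1}$ be given by $\lambda_i=V_{i-1}^{ -1}V_i^{ -1}$. Then for all positive integers $n$ and $k$, \[ \mu^{\le 2k-1}_{ -2n}(\mathbf{0},\boldsymbol{\lambda})=V_0\sum_{\pi\in\mathrm{PV}^{2,2k-1}_{2n-1}}\mathrm{wt}(\pi). \]
   Context: $\mathbf{0}=(0,0,\dots)$. A Motzkin path is a finite sequence of points in $\mathbb{Z}\times\mathbb{Z}_{\ge0}$ whose steps are each $(1,1)$, $(1,0)$ or $(1,-1)$; for sequences $\mathbf{b}=(b_i)_{i\ge0}$, $\boldsymbol{\lambda}$ its weight is the product of $b_i$ over horizontal steps starting at height $i$ and $\lambda_i$ over down steps starting at height $i$. $\mu^{\le K}_N(\mathbf{b},\boldsymbol{\lambda})$ ($N\ge0$) is the sum of weights of Motzkin paths from $(0,0)$ to $(N,0)$ staying weakly below $y=K$. If $(f_N)_{N\ge0}$ satisfies $f_N=c_1f_{N-1}+\cdots+c_df_{N-d}$ for all $N\ge d$ with $c_d\ne0$, it is extended uniquely to all $N\in\mathbb{Z}$ so that the recurrence holds for all $N$; $\mu^{\le K}_{ -N}$ denotes this extension (it exists here). The weight of a sequence $(a_1,\dots,a_N)$ is $V_{a_1}\cdots V_{a_N}$. A $2$-peak-valley sequence is a sequence $(a_1,\dots,a_N)$ of nonnegative integers such that, with $a_0=a_{N+1}=0$, each even $a_i$ satisfies $a_{i-1}>a_i<a_{i+1}$ and each odd $a_i$ satisfies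 $a_{i-1}<a_i>a_{i+1}$; $\mathrm{PV}^{2,K}_N$ is the set of those of length $N$ with all entries in $\{0,\dots,K\}$. -}

module Defs where

open import Level using (_⊔_)
open import Algebra.Bundles using (CommutativeRing)
open import Data.Nat as ℕ using (ℕ; zero; suc; _<ᵇ_; _≡ᵇ_; _≤_)
open import Data.Integer as ℤ using (ℤ; +_)
open import Data.Bool using (Bool; true; false; _∧_; not; if_then_else_)
open import Data.List using (List; []; _∷_; map; concatMap; filterᵇ; foldr; upTo)
open import Data.Product using (Σ; _×_; ∃)

data Step : Set where
  U H D : Step

allSteps : ℕ → List (List Step)
allSteps zero = [] ∷ []
allSteps (suc N) = concatMap (λ s → map (s ∷_) (allSteps N)) (U ∷ H ∷ D ∷ [])

validMotzkin : ℕ → ℕ → List Step → Bool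
validMotzkin K h [] = h ≡ᵇ 0
validMotzkin K h (U ∷ s) = (h <ᵇ K) ∧ validMotzkin K (suc h) s
validMotzkin K h (H ∷ s) = validMotzkin K h s
validMotzkin K zero (D ∷ s) = false
validMotzkin K (suc h) (D ∷ s) = validMotzkin K h s

allSeqs : ℕ → ℕ → List (List ℕ)
allSeqs K zero = [] ∷ []
allSeqs K (suc N) = concatMap (λ a → map (a ∷_) (allSeqs K N)) (upTo (suc K))

isEven : ℕ → Bool
isEven zero = true
isEven (suc n) = not (isEven n)

pvCond : ℕ → ℕ → ℕ → Bool
pvCond p x q = if isEven x then (x <ᵇ p) ∧ (x <ᵇ q) else (p <ᵇ x) ∧ (q <ᵇ x)

headOr0 : List ℕ → ℕ
headOr0 [] = 0
headOr0 (y ∷ _) = y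

-- pvOk prev s : every entry of s satisfies the condition, with left neighbour
-- prev for the first entry and right neighbour 0 after the last (a_{N+1} = 0).
pvOk : ℕ → List ℕ → Bool
pvOk prev [] = true
pvOk prev (x ∷ rest) = pvCond prev x (headOr0 rest) ∧ pvOk x rest

PV2 : ℕ → ℕ → List (List ℕ)
PV2 K N = filterᵇ (pvOk 0) (allSeqs K N)

module _ {c ℓ} (R : CommutativeRing c ℓ) where
  open CommutativeRing R

  rsum : List Carrier → Carrier
  rsum = foldr _+_ 0#

  rprod : List Carrier → Carrier
  rprod = foldr _*_ 1#

  pathWt : (ℕ → Carrier) → (ℕ → Carrier) → ℕ → List Step → Carrier
  pathWt b lam h [] = 1#
  pathWt b lam h (U ∷ s) = pathWt b lam (suc h) s
  pathWt b lam h (H ∷ s) = b h * pathWt b lam h s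
  pathWt b lam zero (D ∷ s) = 1#   -- never occurs in a valid path
  pathWt b lam (suc h) (D ∷ s) = lam (suc h) * pathWt b lam h s

  μ≤ : ℕ → (ℕ → Carrier) → (ℕ → Carrier) → ℕ → Carrier
  μ≤ K b lam N = rsum (map (pathWt b lam 0) (filterᵇ (validMotzkin K 0) (allSteps N)))

  seqWt : (ℕ → Carrier) → List ℕ → Carrier
  seqWt V a = rprod (map V a)

  recSum : (ℕ → Carrier) → (ℤ → Carrier) → ℤ → ℕ → Carrier
  recSum cf f N zero = 0#
  recSum cf f N (suc j) = recSum cf f N j + cf (suc j) * f (N ℤ.- + suc j)

  -- f : ℤ → R is the extension to all of ℤ of the sequence g : ℕ → R along
  -- a linear recurrence f_N = c_1 f_{N-1} + ... + c_d f_{N-d} (d ≥ 1)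
  -- whose last coefficient c_d is nonzero (here: invertible).
  IsRecExtension : (ℕ → Carrier) → (ℤ → Carrier) → Set (c ⊔ ℓ)
  IsRecExtension g f =
    ((N : ℕ) → f (+ N) ≈ g N) ×
    Σ ℕ (λ d → 1 ≤ d × Σ (ℕ → Carrier) (λ cf →
       (∃ λ u → cf d * u ≈ 1#) ×
       ((N : ℤ) → f N ≈ recSum cf f N d)))

  zeroSeq : ℕ → Carrier
  zeroSeq _ = 0#

  -- λ_i = V_{i-1}^{-1} V_i^{-1} for i ≥ 1 (λ_0 is never used)
  lamV : (ℕ → Carrier) → ℕ → Carrier
  lamV Vinv zero = 0#
  lamV Vinv (suc i) = Vinv i * Vinv (suc i)

{-# OPTIONS --safe #-}
-- μ^{≤K}_N is the entry at height 0 of T^N δ₀, for the tridiagonal transfer matrix T of paths of height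
-- at most K. For odd K and λ_i = V_{i-1}⁻¹ V_i⁻¹ the matrix T is invertible and the backward orbit of δ₀
-- is explicit: T^{-(m+1)} δ₀ has entry c_h q_m(h) at height h, where c_h = ± V₀ V₀⁻¹ ⋯ V_{h-1}⁻¹ and
-- q_m(h) sums the weights of the continuations of length m of a 2-peak-valley sequence after an entry h.
-- The whole orbit z ↦ (T^z δ₀)₀ satisfies the recurrence of order K + 1 given by the characteristic
-- polynomial of T (Cayley–Hamilton on δ₀, carried to negative z by injectivity of T), whose last
-- coefficient ± λ₁ λ₃ ⋯ λ_K is a unit. Extensions along recurrences with invertible last coefficient are
-- unique, so the extension at -2n is V₀ q_{2n-1}(0), which is V₀ times the peak-valley sum.
module Submission where

open import Defs
open import Level using (Level; _⊔_)
open import Algebra.Bundles using (CommutativeRing)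
open import Data.Nat as ℕ using (ℕ; zero; suc; _<ᵇ_; _≡ᵇ_; z≤n; s≤s)
import Data.Nat.Properties as ℕP
open import Data.Integer as ℤ using (ℤ; +_; -[1+_])
import Data.Integer.Properties as ℤP
open import Data.Integer.Tactic.RingSolver using () renaming (solve-∀ to ℤ-solve-∀)
open import Data.Sign as Sign using (Sign)
open import Data.Maybe using (Maybe; just; nothing)
open import Data.Bool using (Bool; true; false; _∧_; not; if_then_else_)
open import Data.Bool.Properties using (T-≡; not-involutive; ∧-identityʳ; ∧-zeroʳ; ∧-idem)
open import Data.List using (List; []; _∷_; _++_; map; filterᵇ; concat; concatMap; applyUpTo; upTo)
import Data.List.Properties as ListP
open import Data.Product using (Σ; _×_; _,_; ∃; proj₁; proj₂)
open import Data.Sum using (_⊎_; inj₁; inj₂)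
open import Data.Empty using (⊥-elim)
open import Function using (_∘_; Equivalence)
open import Relation.Nullary using (yes; no)
open import Relation.Binary.Definitions using (tri<; tri≈; tri>)
open import Relation.Binary.PropositionalEquality as P using (_≡_; _≢_)
open import Algebra.Solver.Ring.AlmostCommutativeRing
  using (AlmostCommutativeRing; fromCommutativeRing; _-Raw-AlmostCommutative⟶_)
-- The ring solver normalises with coefficients in ℤ, read in R through the canonical homomorphism;
-- with coefficients in R itself it could not see that e.g. 1# - 1# vanishes.
module ℤ-CoefficientSolver {c ℓ} (R : CommutativeRing c ℓ) where
  open CommutativeRing R
  open import Algebra.Properties.Ring ring
    using (-‿involutive; -0#≈0#; -‿distribˡ-*; -‿distribʳ-*; -‿+-comm)
  open import Algebra.Properties.Semiring.Mult semiring using (×-homo-+; ×1-homo-*)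
    renaming (_×_ to _×′_)
  open import Relation.Binary.Reasoning.Setoid setoid

  ⟦_⟧ : ℤ → Carrier
  ⟦ + n ⟧ = n ×′ 1#
  ⟦ -[1+ n ] ⟧ = - (suc n ×′ 1#)

  private
    ⟦sign⟧ : Sign → Carrier
    ⟦sign⟧ Sign.+ = 1#
    ⟦sign⟧ Sign.- = - 1#

    ⟦sign⟧-* : ∀ s t → ⟦sign⟧ (s Sign.* t) ≈ ⟦sign⟧ s * ⟦sign⟧ t
    ⟦sign⟧-* Sign.+ t = sym (*-identityˡ _)
    ⟦sign⟧-* Sign.- Sign.+ = sym (*-identityʳ _)
    ⟦sign⟧-* Sign.- Sign.- = begin
      1#            ≈⟨ sym (-‿involutive _) ⟩
      - - 1#        ≈⟨ -‿cong (sym (*-identityʳ _)) ⟩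
      - (- 1# * 1#) ≈⟨ -‿distribʳ-* _ _ ⟩
      - 1# * - 1#   ∎

    ⟦◃⟧ : ∀ s n → ⟦ s ℤ.◃ n ⟧ ≈ ⟦sign⟧ s * (n ×′ 1#)
    ⟦◃⟧ Sign.+ zero = sym (zeroʳ _)
    ⟦◃⟧ Sign.- zero = sym (zeroʳ _)
    ⟦◃⟧ Sign.+ (suc n) = sym (*-identityˡ _)
    ⟦◃⟧ Sign.- (suc n) = trans (-‿cong (sym (*-identityˡ _))) (-‿distribˡ-* _ _)

    sign-abs : ∀ i → ⟦ i ⟧ ≈ ⟦sign⟧ (ℤ.sign i) * (ℤ.∣ i ∣ ×′ 1#)
    sign-abs i = trans (reflexive (P.cong ⟦_⟧ (P.sym (ℤP.◃-inverse i)))) (⟦◃⟧ (ℤ.sign i) ℤ.∣ i ∣)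

    ⊖-homo : ∀ m n → ⟦ m ℤ.⊖ n ⟧ ≈ m ×′ 1# - n ×′ 1#
    ⊖-homo zero zero = sym (trans (+-cong refl -0#≈0#) (+-identityʳ _))
    ⊖-homo zero (suc n) = sym (+-identityˡ _)
    ⊖-homo (suc m) zero = sym (trans (+-cong refl -0#≈0#) (+-identityʳ _))
    ⊖-homo (suc m) (suc n) = begin
      ⟦ suc m ℤ.⊖ suc n ⟧         ≡⟨ P.cong ⟦_⟧ (ℤP.[1+m]⊖[1+n]≡m⊖n m n) ⟩
      ⟦ m ℤ.⊖ n ⟧                 ≈⟨ ⊖-homo m n ⟩
      x - y                       ≈⟨ sym (+-cong (+-identityˡ _) refl) ⟩
      (0# + x) - y                ≈⟨ +-cong (+-cong (sym (-‿inverseʳ 1#)) refl) refl ⟩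
      ((1# - 1#) + x) - y         ≈⟨ +-cong (trans (+-assoc _ _ _) (+-cong refl (+-comm _ _))) refl ⟩
      (1# + (x - 1#)) - y         ≈⟨ +-cong (sym (+-assoc _ _ _)) refl ⟩
      ((1# + x) - 1#) - y         ≈⟨ +-assoc _ _ _ ⟩
      (1# + x) + (- 1# - y)       ≈⟨ +-cong refl (-‿+-comm 1# y) ⟩
      (1# + x) - (1# + y)         ∎
      where
      x y : Carrier
      x = m ×′ 1#
      y = n ×′ 1#

    +-homo : ∀ i j → ⟦ i ℤ.+ j ⟧ ≈ ⟦ i ⟧ + ⟦ j ⟧
    +-homo (+ m) (+ n) = ×-homo-+ 1# m n
    +-homo (+ m) -[1+ n ] = ⊖-homo m (suc n)
    +-homo -[1+ m ] (+ n) = trans (⊖-homo n (suc m)) (+-comm _ _)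
    +-homo -[1+ m ] -[1+ n ] = begin
      - (1# + (1# + (m ℕ.+ n) ×′ 1#))   ≈⟨ -‿cong (+-cong refl (+-cong refl (×-homo-+ 1# m n))) ⟩
      - (1# + (1# + (x + y)))
        ≈⟨ -‿cong (+-cong refl (trans (sym (+-assoc _ _ _)) (trans (+-cong (+-comm _ _) refl) (+-assoc _ _ _)))) ⟩
      - (1# + (x + (1# + y)))          ≈⟨ -‿cong (sym (+-assoc _ _ _)) ⟩
      - ((1# + x) + (1# + y))          ≈⟨ sym (-‿+-comm _ _) ⟩
      - (1# + x) + - (1# + y)          ∎
      where
      x y : Carrier
      x = m ×′ 1#
      y = n ×′ 1#

    *-homo : ∀ i j → ⟦ i ℤ.* j ⟧ ≈ ⟦ i ⟧ * ⟦ j ⟧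
    *-homo i j = begin
      ⟦ (ℤ.sign i Sign.* ℤ.sign j) ℤ.◃ (ℤ.∣ i ∣ ℕ.* ℤ.∣ j ∣) ⟧
        ≈⟨ ⟦◃⟧ (ℤ.sign i Sign.* ℤ.sign j) (ℤ.∣ i ∣ ℕ.* ℤ.∣ j ∣) ⟩
      ⟦sign⟧ (ℤ.sign i Sign.* ℤ.sign j) * ((ℤ.∣ i ∣ ℕ.* ℤ.∣ j ∣) ×′ 1#)
        ≈⟨ *-cong (⟦sign⟧-* (ℤ.sign i) (ℤ.sign j)) (×1-homo-* ℤ.∣ i ∣ ℤ.∣ j ∣) ⟩
      (s * t) * (x * y)   ≈⟨ *-assoc _ _ _ ⟩
      s * (t * (x * y))
        ≈⟨ *-cong refl (trans (sym (*-assoc _ _ _)) (trans (*-cong (*-comm _ _) refl) (*-assoc _ _ _))) ⟩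
      s * (x * (t * y))   ≈⟨ sym (*-assoc _ _ _) ⟩
      (s * x) * (t * y)   ≈⟨ sym (*-cong (sign-abs i) (sign-abs j)) ⟩
      ⟦ i ⟧ * ⟦ j ⟧       ∎
      where
      s t x y : Carrier
      s = ⟦sign⟧ (ℤ.sign i)
      t = ⟦sign⟧ (ℤ.sign j)
      x = ℤ.∣ i ∣ ×′ 1#
      y = ℤ.∣ j ∣ ×′ 1#

    neg-homo : ∀ i → ⟦ ℤ.- i ⟧ ≈ - ⟦ i ⟧
    neg-homo (+ zero) = sym -0#≈0#
    neg-homo (+ suc n) = refl
    neg-homo -[1+ n ] = sym (-‿involutive _)

    almostCommutativeRing : AlmostCommutativeRing c ℓ
    almostCommutativeRing = fromCommutativeRing R

    ℤ⟶R : ℤ.+-*-rawRing -Raw-AlmostCommutative⟶ almostCommutativeRing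
    ℤ⟶R = record
      { ⟦_⟧ = ⟦_⟧ ; +-homo = +-homo ; *-homo = *-homo ; -‿homo = neg-homo
      ; 0-homo = refl ; 1-homo = +-identityʳ _ }

    ⟦⟧-equal? : ∀ i j → Maybe (⟦ i ⟧ ≈ ⟦ j ⟧)
    ⟦⟧-equal? i j with i ℤ.≟ j
    ... | yes P.refl = just refl
    ... | no _ = nothing

  open import Algebra.Solver.Ring ℤ.+-*-rawRing almostCommutativeRing ℤ⟶R ⟦⟧-equal?
    using (solve; _:=_; _:+_; _:*_; _:-_; :-_; con) public


isEven-suc-suc : ∀ n → isEven (suc (suc n)) ≡ isEven n
isEven-suc-suc n = not-involutive (isEven n)

parity : ∀ n → isEven n ≡ true ⊎ isEven n ≡ false
parity n with isEven n
... | true = inj₁ P.refl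
... | false = inj₂ P.refl

even≤odd⇒< : ∀ {e n} → isEven e ≡ true → isEven n ≡ false → e ℕ.≤ n → e ℕ.< n
even≤odd⇒< {e} {n} even odd e≤n with ℕP.m≤n⇒m<n∨m≡n e≤n
... | inj₁ e<n = e<n
... | inj₂ P.refl with P.trans (P.sym even) odd
...   | ()

even-pred : ∀ n → isEven (suc n) ≡ true → isEven n ≡ false
even-pred n e = P.trans (P.sym (not-involutive (isEven n))) (P.cong not e)

odd-pred : ∀ n → isEven (suc n) ≡ false → isEven n ≡ true
odd-pred n o = P.trans (P.sym (not-involutive (isEven n))) (P.cong not o)

odd⇒suc-even : ∀ n → isEven n ≡ false → ∃ λ e → suc e ≡ n × isEven e ≡ true
odd⇒suc-even zero ()
odd⇒suc-even (suc e) odd = e , P.refl , odd-pred e odd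

odd-suc : ∀ n → isEven n ≡ false → isEven (suc n) ≡ true
odd-suc _ o = P.cong not o

even-suc : ∀ n → isEven n ≡ true → isEven (suc n) ≡ false
even-suc _ e = P.cong not e

odd⇒positive : ∀ n → isEven n ≡ false → 0 ℕ.< n
odd⇒positive zero ()
odd⇒positive (suc n) _ = s≤s z≤n

isEven-double : ∀ n → isEven (n ℕ.+ n) ≡ true
isEven-double zero = P.refl
isEven-double (suc n) rewrite ℕP.+-suc n n = P.trans (isEven-suc-suc (n ℕ.+ n)) (isEven-double n)

2[1+n]∸1≡1+2n : ∀ n → 2 ℕ.* suc n ℕ.∸ 1 ≡ suc (n ℕ.+ n)
2[1+n]∸1≡1+2n n rewrite ℕP.+-identityʳ n | ℕP.+-suc n n = P.refl

<ᵇ-true : ∀ {m n} → m ℕ.< n → (m <ᵇ n) ≡ true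
<ᵇ-true m<n = Equivalence.to T-≡ (ℕP.<⇒<ᵇ m<n)

<ᵇ-false : ∀ {m n} → n ℕ.≤ m → (m <ᵇ n) ≡ false
<ᵇ-false {m} {n} n≤m with m <ᵇ n in eq
... | false = P.refl
... | true = ⊥-elim (ℕP.<⇒≱ (ℕP.<ᵇ⇒< m n (Equivalence.from T-≡ eq)) n≤m)

≡ᵇ-refl : ∀ m → (m ≡ᵇ m) ≡ true
≡ᵇ-refl m = Equivalence.to T-≡ (ℕP.≡⇒≡ᵇ m m P.refl)

≡ᵇ-false : ∀ {m n} → m ≢ n → (m ≡ᵇ n) ≡ false
≡ᵇ-false {m} {n} m≢n with m ≡ᵇ n in eq
... | false = P.refl
... | true = ⊥-elim (m≢n (ℕP.≡ᵇ⇒≡ m n (Equivalence.from T-≡ eq)))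

module Summation {c ℓ} (R : CommutativeRing c ℓ) where
  open CommutativeRing R
  open import Relation.Binary.Reasoning.Setoid setoid
  open import Algebra.Properties.CommutativeSemigroup +-commutativeSemigroup using (interchange)
  open import Algebra.Properties.Ring ring using (-0#≈0#)

  infixr 8 [_]·_
  [_]·_ : Bool → Carrier → Carrier
  [ b ]· x = if b then x else 0#

  []·-cong : ∀ b {x y} → x ≈ y → [ b ]· x ≈ [ b ]· y
  []·-cong true x≈y = x≈y
  []·-cong false _ = refl

  []·-0# : ∀ b → [ b ]· 0# ≈ 0#
  []·-0# true = refl
  []·-0# false = refl

  []·-∧ : ∀ b b′ x → [ b ∧ b′ ]· x ≈ [ b ]· [ b′ ]· x
  []·-∧ true b′ x = refl
  []·-∧ false b′ x = refl

  []·-* : ∀ b a x → [ b ]· (a * x) ≈ a * [ b ]· x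
  []·-* true a x = refl
  []·-* false a x = sym (zeroʳ a)

  []·-+ : ∀ b x y → [ b ]· (x + y) ≈ [ b ]· x + [ b ]· y
  []·-+ true x y = refl
  []·-+ false x y = sym (+-identityˡ 0#)

  []·-neg : ∀ b x → [ b ]· (- x) ≈ - [ b ]· x
  []·-neg true x = refl
  []·-neg false x = sym -0#≈0#

  []·-≡ᵇ : ∀ m n (f : ℕ → Carrier) → [ m ≡ᵇ n ]· f m ≈ [ m ≡ᵇ n ]· f n
  []·-≡ᵇ m n f with m ≡ᵇ n in m≡n
  ... | true = reflexive (P.cong f (ℕP.≡ᵇ⇒≡ m n (Equivalence.from T-≡ m≡n)))
  ... | false = refl

  []·-absorb : ∀ {b b′} x → (b′ ≡ true → b ≡ true) → [ b ]· [ b′ ]· x ≈ [ b′ ]· x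
  []·-absorb {b} {true} x b′⇒b rewrite b′⇒b P.refl = refl
  []·-absorb {b} {false} x _ = []·-0# b

  []·-true : ∀ {b} x → b ≡ true → [ b ]· x ≈ x
  []·-true x P.refl = refl

  []·-false : ∀ {b} x → b ≡ false → [ b ]· x ≈ 0#
  []·-false x P.refl = refl

  rsum-++ : ∀ xs ys → rsum R (xs ++ ys) ≈ rsum R xs + rsum R ys
  rsum-++ [] ys = sym (+-identityˡ _)
  rsum-++ (x ∷ xs) ys = trans (+-cong refl (rsum-++ xs ys)) (sym (+-assoc _ _ _))

  rsum-map-cong : ∀ {a} {A : Set a} {f g : A → Carrier} → (∀ x → f x ≈ g x) →
                  ∀ xs → rsum R (map f xs) ≈ rsum R (map g xs)
  rsum-map-cong f≈g [] = refl
  rsum-map-cong f≈g (x ∷ xs) = +-cong (f≈g x) (rsum-map-cong f≈g xs)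

  rsum-map-zero : ∀ {a} {A : Set a} {f : A → Carrier} → (∀ x → f x ≈ 0#) → ∀ xs → rsum R (map f xs) ≈ 0#
  rsum-map-zero f≈0 [] = refl
  rsum-map-zero f≈0 (x ∷ xs) = trans (+-cong (f≈0 x) (rsum-map-zero f≈0 xs)) (+-identityˡ 0#)

  rsum-map-* : ∀ {a} {A : Set a} k (f : A → Carrier) xs → rsum R (map (λ x → k * f x) xs) ≈ k * rsum R (map f xs)
  rsum-map-* k f [] = sym (zeroʳ k)
  rsum-map-* k f (x ∷ xs) = trans (+-cong refl (rsum-map-* k f xs)) (sym (distribˡ _ _ _))

  rsum-map-[]· : ∀ {a} {A : Set a} b (f : A → Carrier) xs → rsum R (map (λ x → [ b ]· f x) xs) ≈ [ b ]· rsum R (map f xs)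
  rsum-map-[]· true f xs = refl
  rsum-map-[]· false f xs = rsum-map-zero (λ _ → refl) xs

  rsum-filterᵇ : ∀ {a} {A : Set a} (p : A → Bool) (f : A → Carrier) xs →
                 rsum R (map f (filterᵇ p xs)) ≈ rsum R (map (λ x → [ p x ]· f x) xs)
  rsum-filterᵇ p f [] = refl
  rsum-filterᵇ p f (x ∷ xs) with p x
  ... | true = +-cong refl (rsum-filterᵇ p f xs)
  ... | false = trans (rsum-filterᵇ p f xs) (sym (+-identityˡ _))

  rsum-concat : ∀ {a} {A : Set a} (f : A → Carrier) xss →
                rsum R (map f (concat xss)) ≈ rsum R (map (λ xs → rsum R (map f xs)) xss)
  rsum-concat f [] = refl
  rsum-concat f (xs ∷ xss) = begin
    rsum R (map f (xs ++ concat xss))               ≡⟨ P.cong (rsum R) (ListP.map-++ f xs (concat xss)) ⟩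
    rsum R (map f xs ++ map f (concat xss))         ≈⟨ rsum-++ (map f xs) _ ⟩
    rsum R (map f xs) + rsum R (map f (concat xss)) ≈⟨ +-cong refl (rsum-concat f xss) ⟩
    _                                               ∎

  rsum-concatMap-∷ : ∀ {a} {A : Set a} (f : List A → Carrier) (xs : List A) (L : List (List A)) →
    rsum R (map f (concatMap (λ x → map (x ∷_) L) xs)) ≈ rsum R (map (λ x → rsum R (map (λ s → f (x ∷ s)) L)) xs)
  rsum-concatMap-∷ f xs L = begin
    rsum R (map f (concat (map (λ x → map (x ∷_) L) xs)))
      ≈⟨ rsum-concat f (map (λ x → map (x ∷_) L) xs) ⟩
    rsum R (map (λ ys → rsum R (map f ys)) (map (λ x → map (x ∷_) L) xs))
      ≡⟨ P.cong (rsum R) (P.sym (ListP.map-∘ xs)) ⟩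
    rsum R (map (λ x → rsum R (map f (map (x ∷_) L))) xs)
      ≈⟨ rsum-map-cong (λ x → reflexive (P.cong (rsum R) (P.sym (ListP.map-∘ L)))) xs ⟩
    rsum R (map (λ x → rsum R (map (λ s → f (x ∷ s)) L)) xs) ∎

  Σ< : ℕ → (ℕ → Carrier) → Carrier
  Σ< zero f = 0#
  Σ< (suc n) f = f 0 + Σ< n (f ∘ suc)

  rsum-applyUpTo : ∀ (f : ℕ → Carrier) (g : ℕ → ℕ) n → rsum R (map f (applyUpTo g n)) ≡ Σ< n (f ∘ g)
  rsum-applyUpTo f g zero = P.refl
  rsum-applyUpTo f g (suc n) = P.cong (λ s → f (g 0) + s) (rsum-applyUpTo f (g ∘ suc) n)

  Σ<-cong : ∀ n {f g} → (∀ y → y ℕ.< n → f y ≈ g y) → Σ< n f ≈ Σ< n g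
  Σ<-cong zero f≈g = refl
  Σ<-cong (suc n) f≈g = +-cong (f≈g 0 (s≤s z≤n)) (Σ<-cong n (λ y y<n → f≈g (suc y) (s≤s y<n)))

  Σ<-zero : ∀ n → Σ< n (λ _ → 0#) ≈ 0#
  Σ<-zero zero = refl
  Σ<-zero (suc n) = trans (+-identityˡ _) (Σ<-zero n)

  Σ<-+ : ∀ n f g → Σ< n (λ y → f y + g y) ≈ Σ< n f + Σ< n g
  Σ<-+ zero f g = sym (+-identityˡ _)
  Σ<-+ (suc n) f g = trans (+-cong refl (Σ<-+ n (f ∘ suc) (g ∘ suc))) (interchange _ _ _ _)

  Σ<-* : ∀ n a f → Σ< n (λ y → a * f y) ≈ a * Σ< n f
  Σ<-* zero a f = sym (zeroʳ _)
  Σ<-* (suc n) a f = trans (+-cong refl (Σ<-* n a (f ∘ suc))) (sym (distribˡ _ _ _))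

  Σ<-[]· : ∀ n b f → Σ< n (λ y → [ b ]· f y) ≈ [ b ]· Σ< n f
  Σ<-[]· n true f = refl
  Σ<-[]· n false f = Σ<-zero n

  Σ<-δ : ∀ n {h} (f : ℕ → Carrier) → h ℕ.< n → Σ< n (λ y → [ y ≡ᵇ h ]· f y) ≈ f h
  Σ<-δ (suc n) {zero} f _ = trans (+-cong refl (Σ<-zero n)) (+-identityʳ _)
  Σ<-δ (suc n) {suc h} f (s≤s h<n) = trans (+-identityˡ _) (Σ<-δ n (f ∘ suc) h<n)

module Cancellation {c ℓ} (R : CommutativeRing c ℓ) where
  open CommutativeRing R
  open ℤ-CoefficientSolver R using (solve; _:=_; _:*_; _:+_; _:-_; :-_)
  open import Relation.Binary.Reasoning.Setoid setoid

  Unit : Carrier → Set (c ⊔ ℓ)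
  Unit x = ∃ λ u → x * u ≈ 1#

  Unit-resp : ∀ {x y} → x ≈ y → Unit y → Unit x
  Unit-resp x≈y (u , yu≈1) = u , trans (*-cong x≈y refl) yu≈1

  Unit-* : ∀ {x y} → Unit x → Unit y → Unit (x * y)
  Unit-* {x} {y} (u , xu≈1) (v , yv≈1) = u * v , (begin
    (x * y) * (u * v)   ≈⟨ solve 4 (λ x y u v → (x :* y) :* (u :* v) := (x :* u) :* (y :* v)) refl x y u v ⟩
    (x * u) * (y * v)   ≈⟨ *-cong xu≈1 yv≈1 ⟩
    1# * 1#             ≈⟨ *-identityˡ 1# ⟩
    1#                  ∎)

  Unit-neg : ∀ {x} → Unit x → Unit (- x)
  Unit-neg {x} (u , xu≈1) = - u , trans (solve 2 (λ x u → :- x :* :- u := x :* u) refl x u) xu≈1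

  Unit-cancel : ∀ {x y} → Unit x → x * y ≈ 0# → y ≈ 0#
  Unit-cancel {x} {y} (u , xu≈1) xy≈0 = begin
    y                ≈⟨ sym (*-identityˡ y) ⟩
    1# * y           ≈⟨ *-cong (sym (trans (*-comm u x) xu≈1)) refl ⟩
    (u * x) * y      ≈⟨ *-assoc u x y ⟩
    u * (x * y)      ≈⟨ *-cong refl xy≈0 ⟩
    u * 0#           ≈⟨ zeroʳ u ⟩
    0#               ∎

  +≈0-cancelˡ : ∀ {x y} → x + y ≈ 0# → x ≈ 0# → y ≈ 0#
  +≈0-cancelˡ {x} {y} x+y≈0 x≈0 = trans (sym (trans (+-cong x≈0 refl) (+-identityˡ y))) x+y≈0

  +≈0-cancelʳ : ∀ {x y} → x + y ≈ 0# → y ≈ 0# → x ≈ 0#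
  +≈0-cancelʳ {x} {y} x+y≈0 y≈0 = trans (sym (trans (+-cong refl y≈0) (+-identityʳ x))) x+y≈0

  x-y≈0⇒x≈y : ∀ {x y} → x - y ≈ 0# → x ≈ y
  x-y≈0⇒x≈y {x} {y} x-y≈0 = begin
    x              ≈⟨ solve 2 (λ x y → x := (x :- y) :+ y) refl x y ⟩
    (x - y) + y    ≈⟨ +-cong x-y≈0 refl ⟩
    0# + y         ≈⟨ +-identityˡ y ⟩
    y              ∎

module LinearRecurrences {c ℓ} (R : CommutativeRing c ℓ) where
  open CommutativeRing R
  open ℤ-CoefficientSolver R
  open Summation R using ([_]·_)
  open Cancellation R using (Unit; Unit-cancel; x-y≈0⇒x≈y)
  open import Algebra.Properties.Ring ring using (-0#≈0#)
  open import Relation.Binary.Reasoning.Setoid setoid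

  lagSum : (ℕ → Carrier) → (ℤ → Carrier) → ℤ → ℕ → Carrier
  lagSum = recSum R

  Recurrent : (ℕ → Carrier) → ℕ → (ℤ → Carrier) → Set ℓ
  Recurrent cf d f = ∀ N → f N ≈ lagSum cf f N d

  lagSum-congʳ : ∀ cf {f g} N d → (∀ j → 1 ℕ.≤ j → j ℕ.≤ d → f (N ℤ.- + j) ≈ g (N ℤ.- + j)) →
                 lagSum cf f N d ≈ lagSum cf g N d
  lagSum-congʳ cf N zero f≈g = refl
  lagSum-congʳ cf N (suc d) f≈g =
    +-cong (lagSum-congʳ cf N d (λ j 1≤j j≤d → f≈g j 1≤j (ℕP.m≤n⇒m≤1+n j≤d)))
           (*-cong refl (f≈g (suc d) (s≤s z≤n) ℕP.≤-refl))

  lagSum-zeroʳ : ∀ cf {f} N d → (∀ j → 1 ℕ.≤ j → j ℕ.≤ d → f (N ℤ.- + j) ≈ 0#) → lagSum cf f N d ≈ 0#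
  lagSum-zeroʳ cf N zero f≈0 = refl
  lagSum-zeroʳ cf N (suc d) f≈0 = begin
    lagSum cf _ N d + cf (suc d) * _
      ≈⟨ +-cong (lagSum-zeroʳ cf N d (λ j 1≤j j≤d → f≈0 j 1≤j (ℕP.m≤n⇒m≤1+n j≤d)))
                (*-cong refl (f≈0 (suc d) (s≤s z≤n) ℕP.≤-refl)) ⟩
    0# + cf (suc d) * 0#  ≈⟨ trans (+-identityˡ _) (zeroʳ _) ⟩
    0#                    ∎

  lagSum-+ʳ : ∀ cf f g N d → lagSum cf (λ z → f z + g z) N d ≈ lagSum cf f N d + lagSum cf g N d
  lagSum-+ʳ cf f g N zero = sym (+-identityʳ _)
  lagSum-+ʳ cf f g N (suc d) = trans (+-cong (lagSum-+ʳ cf f g N d) refl) (distrib-step _ _ _ _ _)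
    where
    distrib-step : ∀ x y a u v → (x + y) + a * (u + v) ≈ (x + a * u) + (y + a * v)
    distrib-step = solve 5 (λ x y a u v → (x :+ y) :+ a :* (u :+ v) := (x :+ a :* u) :+ (y :+ a :* v)) refl

  lagSum-subʳ : ∀ cf f g N d → lagSum cf (λ z → f z - g z) N d ≈ lagSum cf f N d - lagSum cf g N d
  lagSum-subʳ cf f g N zero = sym (trans (+-cong refl -0#≈0#) (+-identityʳ _))
  lagSum-subʳ cf f g N (suc d) = trans (+-cong (lagSum-subʳ cf f g N d) refl) (distrib-step _ _ _ _ _)
    where
    distrib-step : ∀ x y a u v → (x - y) + a * (u - v) ≈ (x + a * u) - (y + a * v)
    distrib-step = solve 5 (λ x y a u v → (x :- y) :+ a :* (u :- v) := (x :+ a :* u) :- (y :+ a :* v)) refl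

  lagSum-*ʳ : ∀ cf a f N d → lagSum cf (λ z → a * f z) N d ≈ a * lagSum cf f N d
  lagSum-*ʳ cf a f N zero = sym (zeroʳ _)
  lagSum-*ʳ cf a f N (suc d) = trans (+-cong (lagSum-*ʳ cf a f N d) refl) (distrib-step _ _ _ _)
    where
    distrib-step : ∀ x b a u → a * x + b * (a * u) ≈ a * (x + b * u)
    distrib-step = solve 4 (λ x b a u → a :* x :+ b :* (a :* u) := a :* (x :+ b :* u)) refl

  lagSum-shift : ∀ cf f s N d → lagSum cf (λ z → f (z ℤ.- s)) N d ≈ lagSum cf f (N ℤ.- s) d
  lagSum-shift cf f s N zero = refl
  lagSum-shift cf f s N (suc d) =
    +-cong (lagSum-shift cf f s N d) (*-cong refl (reflexive (P.cong f (sub-comm N s (+ suc d)))))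
    where
    sub-comm : ∀ (N s j : ℤ) → (N ℤ.- j) ℤ.- s ≡ (N ℤ.- s) ℤ.- j
    sub-comm = ℤ-solve-∀

  lagSum-comm : ∀ a b f N m n → lagSum a (λ z → lagSum b f z n) N m ≈ lagSum b (λ z → lagSum a f z m) N n
  lagSum-comm a b f N zero n = sym (lagSum-zeroʳ b N n (λ _ _ _ → refl))
  lagSum-comm a b f N (suc m) n = begin
    lagSum a (λ z → lagSum b f z n) N m + a (suc m) * lagSum b f (N ℤ.- + suc m) n
      ≈⟨ +-cong (lagSum-comm a b f N m n) (*-cong refl (sym (lagSum-shift b f (+ suc m) N n))) ⟩
    lagSum b (λ z → lagSum a f z m) N n + a (suc m) * lagSum b (λ z → f (z ℤ.- + suc m)) N n
      ≈⟨ +-cong refl (sym (lagSum-*ʳ b (a (suc m)) (λ z → f (z ℤ.- + suc m)) N n)) ⟩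
    lagSum b (λ z → lagSum a f z m) N n + lagSum b (λ z → a (suc m) * f (z ℤ.- + suc m)) N n
      ≈⟨ sym (lagSum-+ʳ b (λ z → lagSum a f z m) (λ z → a (suc m) * f (z ℤ.- + suc m)) N n) ⟩
    lagSum b (λ z → lagSum a f z (suc m)) N n ∎

  -- shift₂ a j = a (j - 2), with the junk value 0# for j ≤ 2 (a itself is only read at indices ≥ 1)
  shift₂ : (ℕ → Carrier) → ℕ → Carrier
  shift₂ a zero = 0#
  shift₂ a (suc zero) = 0#
  shift₂ a (suc (suc zero)) = 0#
  shift₂ a (suc (suc (suc j))) = a (suc j)

  lagSum-shift₂ : ∀ a f N m → lagSum (shift₂ a) f N (suc (suc m)) ≈ lagSum a f (N ℤ.- + 2) m
  lagSum-shift₂ a f N zero = trans (+-cong (trans (+-identityˡ _) (zeroˡ _)) (zeroˡ _)) (+-identityˡ _)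
  lagSum-shift₂ a f N (suc m) = +-cong (lagSum-shift₂ a f N m) (*-cong refl (reflexive (P.cong f (sub-sub N (+ m)))))
    where
    sub-sub : ∀ (N j : ℤ) → N ℤ.- (+ 1 ℤ.+ (+ 1 ℤ.+ (+ 1 ℤ.+ j))) ≡ (N ℤ.- + 2) ℤ.- (+ 1 ℤ.+ j)
    sub-sub = ℤ-solve-∀

  lagSum-δ₂ : ∀ l f N m → lagSum (λ j → [ j ≡ᵇ 2 ]· l) f N (suc (suc m)) ≈ l * f (N ℤ.- + 2)
  lagSum-δ₂ l f N zero = trans (+-cong (trans (+-identityˡ _) (zeroˡ _)) refl) (+-identityˡ _)
  lagSum-δ₂ l f N (suc m) = trans (+-cong (lagSum-δ₂ l f N m) (zeroˡ _)) (+-identityʳ _)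

  lagSum-linearˡ : ∀ (a b e : ℕ → Carrier) l f N m →
    lagSum (λ j → (a j + b j) - l * e j) f N m ≈ (lagSum a f N m + lagSum b f N m) - l * lagSum e f N m
  lagSum-linearˡ a b e l f N zero = solve 1 (λ l → con (+ 0) := (con (+ 0) :+ con (+ 0)) :- l :* con (+ 0)) refl l
  lagSum-linearˡ a b e l f N (suc m) = trans (+-cong (lagSum-linearˡ a b e l f N m) refl) (distrib-step _ _ _ _ _ _ _ _)
    where
    distrib-step : ∀ u v w l x y z t → ((u + v) - l * w) + ((x + y) - l * z) * t ≈ ((u + x * t) + (v + y * t)) - l * (w + z * t)
    distrib-step = solve 8 (λ u v w l x y z t →
      ((u :+ v) :- l :* w) :+ ((x :+ y) :- l :* z) :* t := ((u :+ x :* t) :+ (v :+ y :* t)) :- l :* (w :+ z :* t)) refl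

  Recurrent-sub : ∀ {cf d f g} → Recurrent cf d f → Recurrent cf d g → Recurrent cf d (λ z → f z - g z)
  Recurrent-sub {cf} {d} {f} {g} rf rg N = trans (+-cong (rf N) (-‿cong (rg N))) (sym (lagSum-subʳ cf f g N d))

  residual-Recurrent : ∀ {b m f} a n → Recurrent b m f → Recurrent b m (λ z → f z - lagSum a f z n)
  residual-Recurrent {b} {m} {f} a n rf N = sym (begin
    lagSum b (λ z → f z - lagSum a f z n) N m
      ≈⟨ lagSum-subʳ b f (λ z → lagSum a f z n) N m ⟩
    lagSum b f N m - lagSum b (λ z → lagSum a f z n) N m
      ≈⟨ +-cong (sym (rf N)) (-‿cong (lagSum-comm b a f N m n)) ⟩
    f N - lagSum a (λ z → lagSum b f z m) N n
      ≈⟨ +-cong refl (-‿cong (lagSum-congʳ a N n (λ j _ _ → sym (rf (N ℤ.- + j))))) ⟩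
    f N - lagSum a f N n ∎)

  module _ {cf : ℕ → Carrier} {d : ℕ} {f : ℤ → Carrier}
           (last-unit : Unit (cf (suc d))) (rec : Recurrent cf (suc d) f) where

    vanishes-backward : ∀ z → (∀ t → f ((z ℤ.+ + 1) ℤ.+ + t) ≈ 0#) → ∀ t → f (z ℤ.+ + t) ≈ 0#
    vanishes-backward z f≈0 (suc t) = trans (reflexive (P.cong f (P.sym (ℤP.+-assoc z (+ 1) (+ t))))) (f≈0 t)
    vanishes-backward z f≈0 zero = Unit-cancel last-unit (begin
      cf (suc d) * f (z ℤ.+ + 0)              ≡⟨ P.cong (λ w → cf (suc d) * f w) (P.sym (back-to-z z (+ d))) ⟩
      cf (suc d) * f (N ℤ.- + suc d)          ≈⟨ sym (+-identityˡ _) ⟩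
      0# + cf (suc d) * f (N ℤ.- + suc d)     ≈⟨ +-cong (sym (lagSum-zeroʳ cf N d window)) refl ⟩
      lagSum cf f N (suc d)                   ≈⟨ sym (rec N) ⟩
      f N                                     ≈⟨ f≈0 d ⟩
      0#                                      ∎)
      where
      N : ℤ
      N = (z ℤ.+ + 1) ℤ.+ + d
      back-to-z : ∀ (z e : ℤ) → ((z ℤ.+ + 1) ℤ.+ e) ℤ.- (+ 1 ℤ.+ e) ≡ z ℤ.+ + 0
      back-to-z = ℤ-solve-∀
      in-window : ∀ (a j e : ℤ) → (a ℤ.+ (j ℤ.+ e)) ℤ.- j ≡ a ℤ.+ e
      in-window = ℤ-solve-∀
      window : ∀ j → 1 ℕ.≤ j → j ℕ.≤ d → f (N ℤ.- + j) ≈ 0#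
      window j _ j≤d = trans (reflexive (P.cong f eq)) (f≈0 (d ℕ.∸ j))
        where
        eq : N ℤ.- + j ≡ (z ℤ.+ + 1) ℤ.+ + (d ℕ.∸ j)
        eq = P.trans (P.cong (λ e → ((z ℤ.+ + 1) ℤ.+ e) ℤ.- + j)
                             (P.trans (P.cong +_ (P.sym (ℕP.m+[n∸m]≡n j≤d))) (ℤP.pos-+ j (d ℕ.∸ j))))
                     (in-window (z ℤ.+ + 1) (+ j) (+ (d ℕ.∸ j)))

    vanishes-from-tail : ∀ M → (∀ t → f (+ (M ℕ.+ t)) ≈ 0#) → ∀ z → f z ≈ 0#
    vanishes-from-tail M tail = vanish
      where
      shift-zero : ∀ (a b : ℤ) → (a ℤ.- + 0) ℤ.+ b ≡ a ℤ.+ b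
      shift-zero = ℤ-solve-∀
      shift-suc : ∀ (a k t : ℤ) → ((a ℤ.- (+ 1 ℤ.+ k)) ℤ.+ + 1) ℤ.+ t ≡ (a ℤ.- k) ℤ.+ t
      shift-suc = ℤ-solve-∀
      cancel-nonneg : ∀ (a b : ℤ) → (a ℤ.- a) ℤ.+ b ≡ b
      cancel-nonneg = ℤ-solve-∀
      cancel-neg : ∀ (a b : ℤ) → (a ℤ.- (a ℤ.+ b)) ℤ.+ + 0 ≡ ℤ.- b
      cancel-neg = ℤ-solve-∀

      below : ∀ k t → f ((+ M ℤ.- + k) ℤ.+ + t) ≈ 0#
      below zero t = trans (reflexive (P.cong f (shift-zero (+ M) (+ t)))) (tail t)
      below (suc k) = vanishes-backward (+ M ℤ.- + suc k)
        (λ t → trans (reflexive (P.cong f (shift-suc (+ M) (+ k) (+ t)))) (below k t))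

      vanish : ∀ z → f z ≈ 0#
      vanish (+ n) = trans (reflexive (P.cong f (P.sym (cancel-nonneg (+ M) (+ n))))) (below M n)
      vanish -[1+ m ] = trans (reflexive (P.cong f (P.sym (cancel-neg (+ M) (+ suc m))))) (below (M ℕ.+ suc m) 0)

  -- The residual of f′ against the recurrence of f obeys the recurrence of f′ and vanishes on a tail,
  -- so f′ obeys the recurrence of f as well; then f - f′ obeys it and vanishes on ℕ.
  recExtension-unique : ∀ {g f f′} → IsRecExtension R g f → IsRecExtension R g f′ → ∀ z → f z ≈ f′ z
  recExtension-unique {g} {f} {f′} (f≈g , suc d , s≤s z≤n , cf , unit , rec)
                                   (f′≈g , suc d′ , s≤s z≤n , cf′ , unit′ , rec′) z =
    x-y≈0⇒x≈y (vanishes-from-tail {cf} {d} {λ w → f w - f′ w} unit difference-Recurrent 0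
                 (λ t → trans (+-cong (f≈f′ t) refl) (-‿inverseʳ _)) z)
    where
    f≈f′ : ∀ n → f (+ n) ≈ f′ (+ n)
    f≈f′ n = trans (f≈g n) (sym (f′≈g n))

    residual : ℤ → Carrier
    residual w = f′ w - lagSum cf f′ w (suc d)

    residual-tail : ∀ t → residual (+ (suc d ℕ.+ t)) ≈ 0#
    residual-tail t = begin
      f′ N - lagSum cf f′ N (suc d)  ≈⟨ +-cong (sym (f≈f′ _)) (-‿cong (lagSum-congʳ cf N (suc d) in-ℕ)) ⟩
      f N - lagSum cf f N (suc d)    ≈⟨ +-cong (rec N) refl ⟩
      lagSum cf f N (suc d) - lagSum cf f N (suc d) ≈⟨ -‿inverseʳ _ ⟩
      0#                             ∎
      where
      N : ℤ
      N = + (suc d ℕ.+ t)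
      in-ℕ : ∀ j → 1 ℕ.≤ j → j ℕ.≤ suc d → f′ (N ℤ.- + j) ≈ f (N ℤ.- + j)
      in-ℕ j _ j≤d rewrite ℤP.m-n≡m⊖n (suc d ℕ.+ t) j | ℤP.⊖-≥ (ℕP.≤-trans j≤d (ℕP.m≤m+n (suc d) t)) =
        sym (f≈f′ _)

    f′-Recurrent : Recurrent cf (suc d) f′
    f′-Recurrent N =
      x-y≈0⇒x≈y (vanishes-from-tail {cf′} {d′} {residual} unit′ (residual-Recurrent {cf′} {suc d′} cf (suc d) rec′)
                                    (suc d) residual-tail N)

    difference-Recurrent : Recurrent cf (suc d) (λ w → f w - f′ w)
    difference-Recurrent = Recurrent-sub {cf} {suc d} rec f′-Recurrent

module TransferOperator {c ℓ} (R : CommutativeRing c ℓ) (lam : ℕ → CommutativeRing.Carrier R) (K : ℕ) where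
  open CommutativeRing R
  open Summation R
  open Cancellation R
  open ℤ-CoefficientSolver R
  open LinearRecurrences R
  open import Algebra.Properties.Ring ring using (-0#≈0#)
  open import Relation.Binary.Reasoning.Setoid setoid

  Vector : Set c
  Vector = ℕ → Carrier

  infix 4 _≈ᴷ_
  _≈ᴷ_ : Vector → Vector → Set ℓ
  v ≈ᴷ w = ∀ h → h ℕ.≤ K → v h ≈ w h

  ≈ᴷ-trans : ∀ {u v w} → u ≈ᴷ v → v ≈ᴷ w → u ≈ᴷ w
  ≈ᴷ-trans u≈v v≈w h h≤K = trans (u≈v h h≤K) (v≈w h h≤K)

  ≈ᴷ-sym : ∀ {v w} → v ≈ᴷ w → w ≈ᴷ v
  ≈ᴷ-sym v≈w h h≤K = sym (v≈w h h≤K)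

  zeroVector : Vector
  zeroVector _ = 0#

  -- The transfer matrix of Motzkin paths of height at most K with zero horizontal weights.
  T : Vector → Vector
  T w zero = [ 0 <ᵇ K ]· w 1
  T w (suc h) = [ suc h <ᵇ K ]· w (suc (suc h)) + lam (suc h) * w h

  T-cong : ∀ {v w} → v ≈ᴷ w → T v ≈ᴷ T w
  T-cong {v} {w} v≈w = pointwise
    where
    up : ∀ h → [ h <ᵇ K ]· v (suc h) ≈ [ h <ᵇ K ]· w (suc h)
    up h with h <ᵇ K in h<K
    ... | true = v≈w (suc h) (ℕP.<ᵇ⇒< h K (Equivalence.from T-≡ h<K))
    ... | false = refl
    pointwise : T v ≈ᴷ T w
    pointwise zero _ = up 0
    pointwise (suc h) h<K = +-cong (up (suc h)) (*-cong refl (v≈w h (ℕP.<⇒≤ h<K)))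

  T-+ : ∀ v w h → T (λ x → v x + w x) h ≈ T v h + T w h
  T-+ v w zero = []·-+ (0 <ᵇ K) (v 1) (w 1)
  T-+ v w (suc h) = trans (+-cong ([]·-+ (suc h <ᵇ K) _ _) (distribˡ _ _ _)) (interchange _ _ _ _)
    where open import Algebra.Properties.CommutativeSemigroup +-commutativeSemigroup using (interchange)

  T-* : ∀ a w h → T (λ x → a * w x) h ≈ a * T w h
  T-* a w zero = []·-* (0 <ᵇ K) a (w 1)
  T-* a w (suc h) = trans (+-cong ([]·-* (suc h <ᵇ K) a _) refl) (factor _ _ _ _)
    where
    factor : ∀ a u l v → a * u + l * (a * v) ≈ a * (u + l * v)
    factor = solve 4 (λ a u l v → a :* u :+ l :* (a :* v) := a :* (u :+ l :* v)) refl

  T-neg : ∀ w h → T (λ x → - w x) h ≈ - T w h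
  T-neg w zero = []·-neg (0 <ᵇ K) (w 1)
  T-neg w (suc h) = trans (+-cong ([]·-neg (suc h <ᵇ K) _) refl) (factor _ _ _)
    where
    factor : ∀ u l v → - u + l * - v ≈ - (u + l * v)
    factor = solve 3 (λ u l v → :- u :+ l :* :- v := :- (u :+ l :* v)) refl

  T-sub : ∀ v w h → T (λ x → v x - w x) h ≈ T v h - T w h
  T-sub v w h = trans (T-+ v (λ x → - w x) h) (+-cong refl (T-neg w h))

  T-sub-* : ∀ v l w h → T (λ x → v x - l * w x) h ≈ T v h - l * T w h
  T-sub-* v l w h = trans (T-sub v (λ x → l * w x) h) (+-cong refl (-‿cong (T-* l w h)))

  T-zero : ∀ h → T zeroVector h ≈ 0#
  T-zero zero = []·-0# (0 <ᵇ K)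
  T-zero (suc h) = trans (+-cong ([]·-0# (suc h <ᵇ K)) (zeroʳ _)) (+-identityʳ 0#)

  T^ : ℕ → Vector → Vector
  T^ zero w = w
  T^ (suc n) w = T (T^ n w)

  T^-cong : ∀ n {v w} → v ≈ᴷ w → T^ n v ≈ᴷ T^ n w
  T^-cong zero v≈w = v≈w
  T^-cong (suc n) v≈w = T-cong (T^-cong n v≈w)

  T^-zero : ∀ n → T^ n zeroVector ≈ᴷ zeroVector
  T^-zero zero _ _ = refl
  T^-zero (suc n) h h≤K = trans (T-cong (T^-zero n) h h≤K) (T-zero h)

  Λ : ℕ → Carrier
  Λ zero = 1#
  Λ (suc h) = lam (suc h) * Λ h

  Λbasis : ℕ → Vector
  Λbasis h x = [ x ≡ᵇ h ]· Λ h

  δ₀ : Vector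
  δ₀ = Λbasis 0

  pathWeight : ℕ → List Step → Carrier
  pathWeight h s = [ validMotzkin K h s ]· pathWt R (zeroSeq R) lam h s

  pathSum : ℕ → Vector
  pathSum N h = rsum R (map (pathWeight h) (allSteps N))

  private
    afterStep : Step → ℕ → ℕ → Carrier
    afterStep st N h = rsum R (map (λ s → pathWeight h (st ∷ s)) (allSteps N))

    pathSum-by-first-step : ∀ N h → pathSum (suc N) h ≈ afterStep U N h + (afterStep H N h + afterStep D N h)
    pathSum-by-first-step N h =
      trans (rsum-concatMap-∷ (pathWeight h) (U ∷ H ∷ D ∷ []) (allSteps N)) (+-cong refl (+-cong refl (+-identityʳ _)))

    up-steps : ∀ N h → afterStep U N h ≈ [ h <ᵇ K ]· pathSum N (suc h)
    up-steps N h = trans (rsum-map-cong (λ s → []·-∧ (h <ᵇ K) _ _) (allSteps N)) (rsum-map-[]· (h <ᵇ K) _ (allSteps N))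

    flat-steps : ∀ N h → afterStep H N h ≈ 0#
    flat-steps N h = rsum-map-zero (λ s → trans ([]·-cong (validMotzkin K h s) (zeroˡ _)) ([]·-0# _)) (allSteps N)

    down-steps-0 : ∀ N → afterStep D N 0 ≈ 0#
    down-steps-0 N = rsum-map-zero (λ _ → refl) (allSteps N)

    down-steps : ∀ N h → afterStep D N (suc h) ≈ lam (suc h) * pathSum N h
    down-steps N h = trans (rsum-map-cong (λ s → []·-* (validMotzkin K h s) _ _) (allSteps N)) (rsum-map-* _ _ (allSteps N))

  pathSum-suc : ∀ N h → pathSum (suc N) h ≈ T (pathSum N) h
  pathSum-suc N zero = begin
    pathSum (suc N) 0                                      ≈⟨ pathSum-by-first-step N 0 ⟩
    afterStep U N 0 + (afterStep H N 0 + afterStep D N 0)  ≈⟨ +-cong (up-steps N 0) (+-cong (flat-steps N 0) (down-steps-0 N)) ⟩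
    [ 0 <ᵇ K ]· pathSum N 1 + (0# + 0#)                    ≈⟨ trans (+-cong refl (+-identityʳ 0#)) (+-identityʳ _) ⟩
    T (pathSum N) 0                                        ∎
  pathSum-suc N (suc h) = begin
    pathSum (suc N) (suc h)                                ≈⟨ pathSum-by-first-step N (suc h) ⟩
    afterStep U N (suc h) + (afterStep H N (suc h) + afterStep D N (suc h))
      ≈⟨ +-cong (up-steps N (suc h)) (+-cong (flat-steps N (suc h)) (down-steps N h)) ⟩
    [ suc h <ᵇ K ]· pathSum N (suc (suc h)) + (0# + lam (suc h) * pathSum N h)
      ≈⟨ +-cong refl (+-identityˡ _) ⟩
    T (pathSum N) (suc h)                                  ∎

  pathSum≈T^δ₀ : ∀ N → pathSum N ≈ᴷ T^ N δ₀
  pathSum≈T^δ₀ zero h _ = +-identityʳ _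
  pathSum≈T^δ₀ (suc N) h h≤K = trans (pathSum-suc N h) (T-cong (pathSum≈T^δ₀ N) h h≤K)

  μ≤≈T^δ₀ : ∀ N → μ≤ R K (zeroSeq R) lam N ≈ T^ N δ₀ 0
  μ≤≈T^δ₀ N = trans (rsum-filterᵇ (validMotzkin K 0) _ (allSteps N)) (pathSum≈T^δ₀ N 0 z≤n)

  -- charPoly h w is p_h(T) w for p₀ = 1, p₁ = x, p_{h+2} = x p_{h+1} - λ_{h+1} p_h, the characteristic
  -- polynomials of the leading principal minors of T; and p_h(x) = x^h - Σ_{j=1}^{h} charCoeff h j x^(h-j).
  charPoly : ℕ → Vector → Vector
  charPoly zero w = w
  charPoly (suc zero) w = T w
  charPoly (suc (suc h)) w x = T (charPoly (suc h) w) x - lam (suc h) * charPoly h w x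

  charCoeff : ℕ → ℕ → Carrier
  charCoeff zero j = 0#
  charCoeff (suc zero) j = 0#
  charCoeff (suc (suc h)) j = (charCoeff (suc h) j + [ j ≡ᵇ 2 ]· lam (suc h)) - lam (suc h) * shift₂ (charCoeff h) j

  charCoeff-vanishes : ∀ h j → h ℕ.< j → charCoeff h j ≈ 0#
  charCoeff-vanishes zero j _ = refl
  charCoeff-vanishes (suc zero) j _ = refl
  charCoeff-vanishes (suc (suc h)) (suc (suc (suc j))) (s≤s (s≤s h<j)) = begin
    (charCoeff (suc h) (3 ℕ.+ j) + 0#) - lam (suc h) * charCoeff h (suc j)
      ≈⟨ +-cong (+-cong (charCoeff-vanishes (suc h) _ (s≤s (ℕP.m≤n⇒m≤1+n h<j))) refl)
                (-‿cong (*-cong refl (charCoeff-vanishes h (suc j) h<j))) ⟩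
    (0# + 0#) - lam (suc h) * 0#
      ≈⟨ solve 1 (λ l → (con (+ 0) :+ con (+ 0)) :- l :* con (+ 0) := con (+ 0)) refl (lam (suc h)) ⟩
    0# ∎

  charPoly-cong : ∀ h {v w} → v ≈ᴷ w → charPoly h v ≈ᴷ charPoly h w
  charPoly-cong zero v≈w = v≈w
  charPoly-cong (suc zero) v≈w = T-cong v≈w
  charPoly-cong (suc (suc h)) v≈w x x≤K =
    +-cong (T-cong (charPoly-cong (suc h) v≈w) x x≤K) (-‿cong (*-cong refl (charPoly-cong h v≈w x x≤K)))

  T-charPoly : ∀ h w → T (charPoly h w) ≈ᴷ charPoly h (T w)
  T-charPoly zero w _ _ = refl
  T-charPoly (suc zero) w _ _ = refl
  T-charPoly (suc (suc h)) w x x≤K = begin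
    T (λ y → T (charPoly (suc h) w) y - lam (suc h) * charPoly h w y) x
      ≈⟨ T-sub-* (T (charPoly (suc h) w)) (lam (suc h)) (charPoly h w) x ⟩
    T (T (charPoly (suc h) w)) x - lam (suc h) * T (charPoly h w) x
      ≈⟨ +-cong (T-cong (T-charPoly (suc h) w) x x≤K) (-‿cong (*-cong refl (T-charPoly h w x x≤K))) ⟩
    charPoly (suc (suc h)) (T w) x ∎

  T^-charPoly : ∀ n h w → T^ n (charPoly h w) ≈ᴷ charPoly h (T^ n w)
  T^-charPoly zero h w _ _ = refl
  T^-charPoly (suc n) h w = ≈ᴷ-trans (T-cong (T^-charPoly n h w)) (T-charPoly h (T^ n w))

  T-Λbasis-zero : T (Λbasis 0) ≈ᴷ Λbasis 1
  T-Λbasis-zero zero _ = []·-0# (0 <ᵇ K)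
  T-Λbasis-zero (suc zero) _ = trans (+-cong ([]·-0# (1 <ᵇ K)) refl) (+-identityˡ _)
  T-Λbasis-zero (suc (suc x)) _ = trans (+-cong ([]·-0# (suc (suc x) <ᵇ K)) (zeroʳ _)) (+-identityˡ 0#)

  T-Λbasis-suc : ∀ h → suc h ℕ.≤ K → T (Λbasis (suc h)) ≈ᴷ (λ x → Λbasis (suc (suc h)) x + lam (suc h) * Λbasis h x)
  T-Λbasis-suc zero 1≤K zero _ = trans ([]·-true _ (<ᵇ-true 1≤K)) (sym (+-identityˡ _))
  T-Λbasis-suc (suc h) _ zero _ = trans ([]·-0# (0 <ᵇ K)) (sym (trans (+-identityˡ _) (zeroʳ _)))
  T-Λbasis-suc h h<K (suc x) _ = begin
    [ suc x <ᵇ K ]· [ suc x ≡ᵇ h ]· Λ (suc h) + lam (suc x) * [ x ≡ᵇ suc h ]· Λ (suc h)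
      ≈⟨ +-comm _ _ ⟩
    lam (suc x) * [ x ≡ᵇ suc h ]· Λ (suc h) + [ suc x <ᵇ K ]· [ suc x ≡ᵇ h ]· Λ (suc h)
      ≈⟨ +-cong (trans (sym ([]·-* (x ≡ᵇ suc h) _ _)) ([]·-≡ᵇ x (suc h) (λ y → lam (suc y) * Λ (suc h))))
                (trans ([]·-absorb _ below-K) ([]·-* (suc x ≡ᵇ h) _ _)) ⟩
    [ x ≡ᵇ suc h ]· Λ (suc (suc h)) + lam (suc h) * [ suc x ≡ᵇ h ]· Λ h ∎
    where
    below-K : (suc x ≡ᵇ h) ≡ true → (suc x <ᵇ K) ≡ true
    below-K x+1≡h = <ᵇ-true (P.subst (ℕ._< K) (P.sym (ℕP.≡ᵇ⇒≡ (suc x) h (Equivalence.from T-≡ x+1≡h))) h<K)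

  charPoly-δ₀ : ∀ h → h ℕ.≤ K → (charPoly h δ₀ ≈ᴷ Λbasis h) × (charPoly (suc h) δ₀ ≈ᴷ Λbasis (suc h))
  charPoly-δ₀ zero _ = (λ _ _ → refl) , T-Λbasis-zero
  charPoly-δ₀ (suc h) h<K = proj₂ IH , step
    where
    IH : (charPoly h δ₀ ≈ᴷ Λbasis h) × (charPoly (suc h) δ₀ ≈ᴷ Λbasis (suc h))
    IH = charPoly-δ₀ h (ℕP.<⇒≤ h<K)
    step : charPoly (suc (suc h)) δ₀ ≈ᴷ Λbasis (suc (suc h))
    step x x≤K = begin
      T (charPoly (suc h) δ₀) x - lam (suc h) * charPoly h δ₀ x
        ≈⟨ +-cong (T-cong (proj₂ IH) x x≤K) (-‿cong (*-cong refl (proj₁ IH x x≤K))) ⟩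
      T (Λbasis (suc h)) x - lam (suc h) * Λbasis h x
        ≈⟨ +-cong (T-Λbasis-suc h h<K x x≤K) refl ⟩
      (Λbasis (suc (suc h)) x + lam (suc h) * Λbasis h x) - lam (suc h) * Λbasis h x
        ≈⟨ solve 2 (λ a b → (a :+ b) :- b := a) refl _ _ ⟩
      Λbasis (suc (suc h)) x ∎

  cayley-hamilton-δ₀ : charPoly (suc K) δ₀ ≈ᴷ zeroVector
  cayley-hamilton-δ₀ = ≈ᴷ-trans (proj₂ (charPoly-δ₀ K ℕP.≤-refl))
    (λ x x≤K → []·-false _ (≡ᵇ-false (ℕP.<⇒≢ (s≤s x≤K))))

  module Orbit (G : ℤ → Vector) (orbit : ∀ z → T (G z) ≈ᴷ G (z ℤ.+ + 1)) where

    column : ℕ → ℤ → Carrier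
    column x z = G z x

    G-≡ : ∀ {z z′} → z ≡ z′ → G z ≈ᴷ G z′
    G-≡ P.refl _ _ = refl

    T^-orbit : ∀ n z → T^ n (G z) ≈ᴷ G (z ℤ.+ + n)
    T^-orbit zero z = G-≡ (P.sym (ℤP.+-identityʳ z))
    T^-orbit (suc n) z = ≈ᴷ-trans (T-cong (T^-orbit n z)) (≈ᴷ-trans (orbit (z ℤ.+ + n)) (G-≡ (assoc z (+ n))))
      where
      assoc : ∀ (z a : ℤ) → (z ℤ.+ a) ℤ.+ + 1 ≡ z ℤ.+ (+ 1 ℤ.+ a)
      assoc = ℤ-solve-∀

    T-lagSum : ∀ a N m → T (λ x → lagSum a (column x) N m) ≈ᴷ (λ x → lagSum a (column x) (N ℤ.+ + 1) m)
    T-lagSum a N zero x _ = T-zero x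
    T-lagSum a N (suc m) x x≤K = begin
      T (λ y → lagSum a (column y) N m + a (suc m) * G (N ℤ.- + suc m) y) x
        ≈⟨ T-+ (λ y → lagSum a (column y) N m) (λ y → a (suc m) * G (N ℤ.- + suc m) y) x ⟩
      T (λ y → lagSum a (column y) N m) x + T (λ y → a (suc m) * G (N ℤ.- + suc m) y) x
        ≈⟨ +-cong (T-lagSum a N m x x≤K) (trans (T-* (a (suc m)) (G (N ℤ.- + suc m)) x)
                  (*-cong refl (≈ᴷ-trans (orbit _) (G-≡ (shift N (+ m))) x x≤K))) ⟩
      lagSum a (column x) (N ℤ.+ + 1) (suc m) ∎
      where
      shift : ∀ (N a : ℤ) → (N ℤ.- (+ 1 ℤ.+ a)) ℤ.+ + 1 ≡ (N ℤ.+ + 1) ℤ.- (+ 1 ℤ.+ a)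
      shift = ℤ-solve-∀

    charPoly-orbit : ∀ h z → charPoly h (G z) ≈ᴷ (λ x → G (z ℤ.+ + h) x - lagSum (charCoeff h) (column x) (z ℤ.+ + h) h)
    charPoly-orbit zero z x x≤K = sym (trans (+-cong (G-≡ (ℤP.+-identityʳ z) x x≤K) -0#≈0#) (+-identityʳ _))
    charPoly-orbit (suc zero) z x x≤K =
      trans (orbit z x x≤K) (sym (trans (+-cong refl (trans (-‿cong (trans (+-identityˡ _) (zeroˡ _))) -0#≈0#)) (+-identityʳ _)))
    charPoly-orbit (suc (suc h)) z x x≤K = begin
      T (charPoly (suc h) (G z)) x - l * charPoly h (G z) x
        ≈⟨ +-cong (T-cong (charPoly-orbit (suc h) z) x x≤K) (-‿cong (*-cong refl (charPoly-orbit h z x x≤K))) ⟩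
      T (λ y → G z₁ y - lagSum r₁ (column y) z₁ (suc h)) x - l * (G z₀ x - lagSum r₀ (column x) z₀ h)
        ≈⟨ +-cong (T-sub (G z₁) (λ y → lagSum r₁ (column y) z₁ (suc h)) x) refl ⟩
      (T (G z₁) x - T (λ y → lagSum r₁ (column y) z₁ (suc h)) x) - l * (G z₀ x - lagSum r₀ (column x) z₀ h)
        ≈⟨ +-cong (+-cong (orbit z₁ x x≤K) (-‿cong (T-lagSum r₁ z₁ (suc h) x x≤K))) refl ⟩
      (G (z₁ ℤ.+ + 1) x - lagSum r₁ (column x) (z₁ ℤ.+ + 1) (suc h)) - l * (G z₀ x - lagSum r₀ (column x) z₀ h)
        ≡⟨ P.cong₂ (λ w v → (G w x - lagSum r₁ (column x) w (suc h)) - l * (G v x - lagSum r₀ (column x) v h))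
                   (z₁+1≡M z (+ h)) (z₀≡M-2 z (+ h)) ⟩
      (G M x - lagSum r₁ (column x) M (suc h)) - l * (G (M ℤ.- + 2) x - lagSum r₀ (column x) (M ℤ.- + 2) h)
        ≈⟨ solve 5 (λ g r l g₂ r₀ → (g :- r) :- l :* (g₂ :- r₀) := g :- ((r :+ l :* g₂) :- l :* r₀)) refl _ _ _ _ _ ⟩
      G M x - ((lagSum r₁ (column x) M (suc h) + l * G (M ℤ.- + 2) x) - l * lagSum r₀ (column x) (M ℤ.- + 2) h)
        ≈⟨ +-cong refl (-‿cong (sym lagSum-r₂)) ⟩
      G M x - lagSum (charCoeff (suc (suc h))) (column x) M (suc (suc h)) ∎
      where
      l : Carrier
      l = lam (suc h)
      r₀ r₁ : ℕ → Carrier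
      r₀ = charCoeff h
      r₁ = charCoeff (suc h)
      z₀ z₁ M : ℤ
      z₀ = z ℤ.+ + h
      z₁ = z ℤ.+ + suc h
      M = z ℤ.+ + suc (suc h)
      z₁+1≡M : ∀ (z a : ℤ) → (z ℤ.+ (+ 1 ℤ.+ a)) ℤ.+ + 1 ≡ z ℤ.+ (+ 1 ℤ.+ (+ 1 ℤ.+ a))
      z₁+1≡M = ℤ-solve-∀
      z₀≡M-2 : ∀ (z a : ℤ) → z ℤ.+ a ≡ (z ℤ.+ (+ 1 ℤ.+ (+ 1 ℤ.+ a))) ℤ.- + 2
      z₀≡M-2 = ℤ-solve-∀
      lagSum-r₂ : lagSum (charCoeff (suc (suc h))) (column x) M (suc (suc h))
                ≈ (lagSum r₁ (column x) M (suc h) + l * G (M ℤ.- + 2) x) - l * lagSum r₀ (column x) (M ℤ.- + 2) h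
      lagSum-r₂ = begin
        lagSum (charCoeff (suc (suc h))) (column x) M (suc (suc h))
          ≈⟨ lagSum-linearˡ r₁ (λ j → [ j ≡ᵇ 2 ]· l) (shift₂ r₀) l (column x) M (suc (suc h)) ⟩
        (lagSum r₁ (column x) M (suc (suc h)) + lagSum (λ j → [ j ≡ᵇ 2 ]· l) (column x) M (suc (suc h)))
          - l * lagSum (shift₂ r₀) (column x) M (suc (suc h))
          ≈⟨ +-cong (+-cong top-vanishes (lagSum-δ₂ l (column x) M h))
                    (-‿cong (*-cong refl (lagSum-shift₂ r₀ (column x) M h))) ⟩
        (lagSum r₁ (column x) M (suc h) + l * G (M ℤ.- + 2) x) - l * lagSum r₀ (column x) (M ℤ.- + 2) h ∎
        where
        top-vanishes : lagSum r₁ (column x) M (suc (suc h)) ≈ lagSum r₁ (column x) M (suc h)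
        top-vanishes = trans (+-cong refl (trans (*-cong (charCoeff-vanishes (suc h) (suc (suc h)) ℕP.≤-refl) refl) (zeroˡ _)))
                             (+-identityʳ _)

  module _ (λ-unit : ∀ i → Unit (lam (suc i))) (K-odd : isEven K ≡ false) where

    T-injective : ∀ w → T w ≈ᴷ zeroVector → w ≈ᴷ zeroVector
    T-injective w Tw≈0 h h≤K with parity h
    ... | inj₁ even = even-heights (K ℕ.∸ suc h) h even (ℕP.m+[n∸m]≡n (even≤odd⇒< even K-odd h≤K))
      where
      -- The top row of T w ≈ 0 kills w (K - 1); each lower even row then passes this down by 2.
      even-heights : ∀ d e → isEven e ≡ true → suc (e ℕ.+ d) ≡ K → w e ≈ 0#
      even-heights zero e _ e+1+0≡K =
        Unit-cancel (λ-unit e) (+≈0-cancelˡ (Tw≈0 (suc e) (ℕP.≤-reflexive e+1≡K))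
                                            ([]·-false _ (<ᵇ-false (ℕP.≤-reflexive (P.sym e+1≡K)))))
        where
        e+1≡K : suc e ≡ K
        e+1≡K = P.trans (P.cong suc (P.sym (ℕP.+-identityʳ e))) e+1+0≡K
      even-heights (suc zero) e even e+2≡K
        with P.trans (P.sym K-odd) (P.trans (P.cong isEven K≡e+2) (P.trans (isEven-suc-suc e) even))
        where
        K≡e+2 : K ≡ suc (suc e)
        K≡e+2 = P.sym (P.trans (P.cong suc (ℕP.+-comm 1 e)) e+2≡K)
      ... | ()
      even-heights (suc (suc d)) e even e+d+3≡K =
        Unit-cancel (λ-unit e) (+≈0-cancelˡ (Tw≈0 (suc e) e+1≤K)
          (trans ([]·-cong _ (even-heights d (suc (suc e)) (P.trans (isEven-suc-suc e) even) e+2+d+1≡K)) ([]·-0# _)))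
        where
        e+2+d+1≡K : suc (suc (suc e) ℕ.+ d) ≡ K
        e+2+d+1≡K = P.trans (P.cong suc (P.sym (P.trans (ℕP.+-suc e (suc d)) (P.cong suc (ℕP.+-suc e d))))) e+d+3≡K
        e+1≤K : suc e ℕ.≤ K
        e+1≤K = ℕP.≤-trans (s≤s (ℕP.m≤m+n e _)) (ℕP.≤-reflexive e+d+3≡K)
    ... | inj₂ odd = odd-heights h odd h≤K
      where
      -- Bottom-up: row 0 of T w ≈ 0 kills w 1, and row h+1 passes this up from w h to w (h + 2).
      odd-heights : ∀ h → isEven h ≡ false → h ℕ.≤ K → w h ≈ 0#
      odd-heights (suc zero) _ 1≤K = trans (sym ([]·-true (w 1) (<ᵇ-true 1≤K))) (Tw≈0 0 z≤n)
      odd-heights (suc (suc h)) odd h+2≤K =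
        trans (sym ([]·-true _ (<ᵇ-true h+2≤K)))
              (+≈0-cancelʳ (Tw≈0 (suc h) (ℕP.<⇒≤ h+2≤K))
                 (trans (*-cong refl (odd-heights h (P.trans (P.sym (isEven-suc-suc h)) odd) h′≤K)) (zeroʳ _)))
        where
        h′≤K : h ℕ.≤ K
        h′≤K = ℕP.≤-trans (ℕP.n≤1+n h) (ℕP.<⇒≤ h+2≤K)

    T^-injective : ∀ n w → T^ n w ≈ᴷ zeroVector → w ≈ᴷ zeroVector
    T^-injective zero w w≈0 = w≈0
    T^-injective (suc n) w Tⁿ⁺¹w≈0 = T^-injective n w (T-injective (T^ n w) Tⁿ⁺¹w≈0)

    charCoeff-top-unit : ∀ e → isEven e ≡ true → Unit (charCoeff (suc (suc e)) (suc (suc e)))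
    charCoeff-top-unit zero _ =
      Unit-resp (solve 1 (λ l → (con (+ 0) :+ l) :- l :* con (+ 0) := l) refl (lam 1)) (λ-unit 0)
    charCoeff-top-unit (suc (suc e)) even =
      Unit-resp top≈ (Unit-neg (Unit-* (λ-unit (suc (suc e))) (charCoeff-top-unit e (P.trans (P.sym (isEven-suc-suc e)) even))))
      where
      l prev : Carrier
      l = lam (suc (suc (suc e)))
      prev = charCoeff (suc (suc e)) (suc (suc e))
      top≈ : charCoeff (4 ℕ.+ e) (4 ℕ.+ e) ≈ - (l * prev)
      top≈ = trans (+-cong (+-cong (charCoeff-vanishes (3 ℕ.+ e) (4 ℕ.+ e) ℕP.≤-refl) refl) refl)
                   (solve 2 (λ l c → (con (+ 0) :+ con (+ 0)) :- l :* c := :- (l :* c)) refl l prev)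

    charCoeff-last-unit : Unit (charCoeff (suc K) (suc K))
    charCoeff-last-unit with odd⇒suc-even K K-odd
    ... | e , P.refl , even = charCoeff-top-unit e even

    orbit-Recurrent : (G : ℤ → Vector) → (∀ z → T (G z) ≈ᴷ G (z ℤ.+ + 1)) → G (+ 0) ≈ᴷ δ₀ →
                      Recurrent (charCoeff (suc K)) (suc K) (λ z → G z 0)
    orbit-Recurrent G orbit G₀≈δ₀ N = begin
      G N 0                                    ≡⟨ P.cong (column 0) (P.sym M≡N) ⟩
      G M 0
        ≈⟨ x-y≈0⇒x≈y (trans (sym (charPoly-orbit (suc K) z 0 z≤n)) (annihilated z 0 z≤n)) ⟩
      lagSum (charCoeff (suc K)) (column 0) M (suc K) ≡⟨ P.cong (λ w → lagSum (charCoeff (suc K)) (column 0) w (suc K)) M≡N ⟩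
      lagSum (charCoeff (suc K)) (column 0) N (suc K) ∎
      where
      open Orbit G orbit
      z M : ℤ
      z = N ℤ.- + suc K
      M = z ℤ.+ + suc K
      M≡N : M ≡ N
      M≡N = sub-add N (+ suc K)
        where
        sub-add : ∀ (N a : ℤ) → (N ℤ.- a) ℤ.+ a ≡ N
        sub-add = ℤ-solve-∀

      -- Positive orbit points are T-images of δ₀, where Cayley–Hamilton applies; negative ones are
      -- T-preimages of δ₀, and injectivity of T transports the identity back to them.
      annihilated : ∀ z → charPoly (suc K) (G z) ≈ᴷ zeroVector
      annihilated (+ n) =
        ≈ᴷ-trans (charPoly-cong (suc K) (≈ᴷ-sym (T^-orbit n (+ 0))))
        (≈ᴷ-trans (charPoly-cong (suc K) (T^-cong n G₀≈δ₀))
        (≈ᴷ-trans (≈ᴷ-sym (T^-charPoly n (suc K) δ₀))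
        (≈ᴷ-trans (T^-cong n cayley-hamilton-δ₀) (T^-zero n))))
      annihilated -[1+ m ] = T^-injective (suc m) _
        (≈ᴷ-trans (T^-charPoly (suc m) (suc K) (G -[1+ m ]))
        (≈ᴷ-trans (charPoly-cong (suc K) (≈ᴷ-trans (T^-orbit (suc m) -[1+ m ]) (G-≡ (ℤP.n⊖n≡0 (suc m)))))
        (≈ᴷ-trans (charPoly-cong (suc K) G₀≈δ₀) cayley-hamilton-δ₀)))

module PeakValleyTails {c ℓ} (R : CommutativeRing c ℓ) (V : ℕ → CommutativeRing.Carrier R) (K : ℕ) where
  open CommutativeRing R
  open Summation R
  open import Relation.Binary.Reasoning.Setoid setoid

  leftOk : ℕ → ℕ → Bool
  leftOk p x = if isEven x then x <ᵇ p else p <ᵇ x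

  rightOk : ℕ → ℕ → Bool
  rightOk x q = if isEven x then x <ᵇ q else q <ᵇ x

  pvCond-split : ∀ p x q → pvCond p x q ≡ leftOk p x ∧ rightOk x q
  pvCond-split p x q with isEven x
  ... | true = P.refl
  ... | false = P.refl

  link : ℕ → ℕ → Bool
  link a y = rightOk a y ∧ leftOk a y

  -- tails m a sums the weights V y₁ ⋯ V y_m of all continuations a, y₁, …, y_m, 0 of a peak-valley sequence.
  tails : ℕ → ℕ → Carrier
  tails zero a = [ rightOk a 0 ]· 1#
  tails (suc m) a = Σ< (suc K) (λ y → [ link a y ]· (V y * tails m y))

  private
    weight : List ℕ → Carrier
    weight = seqWt R V

    startingWith : ℕ → ℕ → ℕ → Carrier
    startingWith N p a = rsum R (map (λ s → [ pvOk p (a ∷ s) ]· weight (a ∷ s)) (allSeqs K N))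

    rsum-allSeqs-suc : ∀ N (f : List ℕ → Carrier) →
      rsum R (map f (allSeqs K (suc N))) ≈ Σ< (suc K) (λ a → rsum R (map (λ s → f (a ∷ s)) (allSeqs K N)))
    rsum-allSeqs-suc N f = trans (rsum-concatMap-∷ f (upTo (suc K)) (allSeqs K N)) (reflexive (rsum-applyUpTo _ (λ y → y) (suc K)))

    startingWith-suc : ∀ N p a → startingWith (suc N) p a ≈ Σ< (suc K) (λ y → [ pvCond p a y ]· (V a * startingWith N a y))
    startingWith-suc N p a =
      trans (rsum-allSeqs-suc N (λ s → [ pvOk p (a ∷ s) ]· weight (a ∷ s))) (Σ<-cong (suc K) (λ y _ → after y))
      where
      after : ∀ y → rsum R (map (λ s → [ pvOk p (a ∷ y ∷ s) ]· weight (a ∷ y ∷ s)) (allSeqs K N))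
                  ≈ [ pvCond p a y ]· (V a * startingWith N a y)
      after y = begin
        rsum R (map (λ s → [ pvCond p a y ∧ pvOk a (y ∷ s) ]· (V a * weight (y ∷ s))) (allSeqs K N))
          ≈⟨ rsum-map-cong (λ s → trans ([]·-∧ (pvCond p a y) (pvOk a (y ∷ s)) _)
                                        ([]·-cong (pvCond p a y) ([]·-* (pvOk a (y ∷ s)) (V a) (weight (y ∷ s))))) (allSeqs K N) ⟩
        rsum R (map (λ s → [ pvCond p a y ]· (V a * [ pvOk a (y ∷ s) ]· weight (y ∷ s))) (allSeqs K N))
          ≈⟨ rsum-map-[]· (pvCond p a y) (λ s → V a * [ pvOk a (y ∷ s) ]· weight (y ∷ s)) (allSeqs K N) ⟩
        [ pvCond p a y ]· rsum R (map (λ s → V a * [ pvOk a (y ∷ s) ]· weight (y ∷ s)) (allSeqs K N))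
          ≈⟨ []·-cong (pvCond p a y) (rsum-map-* (V a) (λ s → [ pvOk a (y ∷ s) ]· weight (y ∷ s)) (allSeqs K N)) ⟩
        [ pvCond p a y ]· (V a * startingWith N a y) ∎

    leftOk∧rightOk : ∀ p a y x → [ pvCond p a y ]· (V a * [ leftOk a y ]· x) ≈ [ leftOk p a ]· (V a * [ link a y ]· x)
    leftOk∧rightOk p a y x = begin
      [ pvCond p a y ]· (V a * [ leftOk a y ]· x)
        ≡⟨ P.cong (λ b → [ b ]· (V a * [ leftOk a y ]· x)) (pvCond-split p a y) ⟩
      [ leftOk p a ∧ rightOk a y ]· (V a * [ leftOk a y ]· x)   ≈⟨ []·-∧ (leftOk p a) (rightOk a y) _ ⟩
      [ leftOk p a ]· [ rightOk a y ]· (V a * [ leftOk a y ]· x) ≈⟨ []·-cong (leftOk p a) ([]·-* (rightOk a y) (V a) _) ⟩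
      [ leftOk p a ]· (V a * [ rightOk a y ]· [ leftOk a y ]· x)
        ≈⟨ []·-cong (leftOk p a) (*-cong refl (sym ([]·-∧ (rightOk a y) (leftOk a y) x))) ⟩
      [ leftOk p a ]· (V a * [ link a y ]· x)                    ∎

    startingWith-tails : ∀ N p a → startingWith N p a ≈ [ leftOk p a ]· (V a * tails N a)
    startingWith-tails zero p a = begin
      [ pvCond p a 0 ∧ true ]· (V a * 1#) + 0#   ≈⟨ +-identityʳ _ ⟩
      [ pvCond p a 0 ∧ true ]· (V a * 1#)
        ≡⟨ P.cong (λ b → [ b ]· (V a * 1#)) (P.trans (∧-identityʳ _) (pvCond-split p a 0)) ⟩
      [ leftOk p a ∧ rightOk a 0 ]· (V a * 1#)   ≈⟨ []·-∧ (leftOk p a) (rightOk a 0) _ ⟩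
      [ leftOk p a ]· [ rightOk a 0 ]· (V a * 1#) ≈⟨ []·-cong (leftOk p a) ([]·-* (rightOk a 0) (V a) 1#) ⟩
      [ leftOk p a ]· (V a * tails 0 a)          ∎
    startingWith-tails (suc N) p a = begin
      startingWith (suc N) p a
        ≈⟨ startingWith-suc N p a ⟩
      Σ< (suc K) (λ y → [ pvCond p a y ]· (V a * startingWith N a y))
        ≈⟨ Σ<-cong (suc K) (λ y _ → trans ([]·-cong (pvCond p a y) (*-cong refl (startingWith-tails N a y)))
                                          (leftOk∧rightOk p a y _)) ⟩
      Σ< (suc K) (λ y → [ leftOk p a ]· (V a * [ link a y ]· (V y * tails N y)))
        ≈⟨ Σ<-[]· (suc K) (leftOk p a) (λ y → V a * [ link a y ]· (V y * tails N y)) ⟩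
      [ leftOk p a ]· Σ< (suc K) (λ y → V a * [ link a y ]· (V y * tails N y))
        ≈⟨ []·-cong (leftOk p a) (Σ<-* (suc K) (V a) (λ y → [ link a y ]· (V y * tails N y))) ⟩
      [ leftOk p a ]· (V a * tails (suc N) a) ∎

    leftOk-0 : ∀ a x → [ leftOk 0 a ]· x ≈ [ link 0 a ]· x
    leftOk-0 a x with isEven a
    ... | true rewrite ∧-zeroʳ (0 <ᵇ a) = refl
    ... | false rewrite ∧-idem (0 <ᵇ a) = refl

  peakValleySum : ∀ N → rsum R (map (seqWt R V) (PV2 K (suc N))) ≈ tails (suc N) 0
  peakValleySum N = begin
    rsum R (map weight (filterᵇ (pvOk 0) (allSeqs K (suc N))))
      ≈⟨ rsum-filterᵇ (pvOk 0) weight (allSeqs K (suc N)) ⟩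
    rsum R (map (λ s → [ pvOk 0 s ]· weight s) (allSeqs K (suc N)))
      ≈⟨ rsum-allSeqs-suc N (λ s → [ pvOk 0 s ]· weight s) ⟩
    Σ< (suc K) (startingWith N 0)
      ≈⟨ Σ<-cong (suc K) (λ a _ → trans (startingWith-tails N 0 a) (leftOk-0 a _)) ⟩
    tails (suc N) 0 ∎

  linkBelow : ℕ → ℕ → Bool
  linkBelow zero y = false
  linkBelow (suc h) y = link h y

  tailsBelow : ℕ → ℕ → Carrier
  tailsBelow m zero = 0#
  tailsBelow m (suc h) = tails (suc m) h

  private
    -- For even h the successors of h + 1 are the even y ≤ h, i.e. h itself and the successors of h - 1.
    link-after-odd : ∀ h → isEven h ≡ true → ∀ y x → [ link (suc h) y ]· x ≈ [ y ≡ᵇ h ]· x + [ linkBelow h y ]· x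
    link-after-odd h even y x with ℕP.<-cmp y h
    link-after-odd zero even y x | tri< () _ _
    link-after-odd (suc h) even y x | tri< y<h+1 _ _ with ℕP.m<1+n⇒m<n∨m≡n y<h+1
    ... | inj₁ y<h
      rewrite even-pred h even | <ᵇ-true (ℕP.<-trans y<h (ℕP.<-trans (ℕP.n<1+n h) (ℕP.n<1+n _)))
            | ≡ᵇ-false (ℕP.<⇒≢ (ℕP.<-trans y<h (ℕP.n<1+n h)))
            | <ᵇ-true y<h | <ᵇ-false {h} {y} (ℕP.<⇒≤ y<h)
            | <ᵇ-false {suc (suc h)} {y} (ℕP.<⇒≤ (ℕP.<-trans y<h (ℕP.<-trans (ℕP.n<1+n h) (ℕP.n<1+n _))))
      = sym (+-identityˡ _)
    ... | inj₂ P.refl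
      rewrite even-pred y even | <ᵇ-true (ℕP.<-trans (ℕP.n<1+n y) (ℕP.n<1+n (suc y)))
            | <ᵇ-false {suc (suc y)} {y} (ℕP.<⇒≤ (ℕP.<-trans (ℕP.n<1+n y) (ℕP.n<1+n _)))
            | ≡ᵇ-false (ℕP.<⇒≢ (ℕP.n<1+n y)) | <ᵇ-false {y} {y} ℕP.≤-refl
      = sym (+-identityˡ _)
    link-after-odd zero even y x | tri≈ _ P.refl _ = sym (+-identityʳ _)
    link-after-odd (suc h) even y x | tri≈ _ P.refl _
      rewrite even-pred h even | <ᵇ-true (ℕP.n<1+n (suc h)) | ≡ᵇ-refl h | <ᵇ-false {suc h} {h} (ℕP.n≤1+n h)
      = sym (+-identityʳ _)
    link-after-odd zero even y x | tri> _ _ 0<y rewrite <ᵇ-false {y} {1} 0<y | ≡ᵇ-false (ℕP.>⇒≢ 0<y) = sym (+-identityʳ _)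
    link-after-odd (suc h) even y x | tri> _ _ h+1<y
      rewrite even-pred h even | <ᵇ-false {y} {suc (suc h)} h+1<y | ≡ᵇ-false (ℕP.>⇒≢ h+1<y)
            | <ᵇ-false {y} {h} (ℕP.≤-trans (ℕP.n≤1+n h) (ℕP.<⇒≤ h+1<y))
      = sym (+-identityʳ _)

    -- For even h the successors of h are the odd y > h, i.e. h + 1 and (below K) the successors of h + 2.
    link-after-even : ∀ h → isEven h ≡ true → ∀ y x → y ℕ.≤ K →
                      [ link h y ]· x ≈ [ y ≡ᵇ suc h ]· x + [ (suc h <ᵇ K) ∧ link (suc (suc h)) y ]· x
    link-after-even h even y x y≤K with ℕP.<-cmp y (suc h)
    ... | tri< y<h+1 _ _
      rewrite even | <ᵇ-false {h} {y} (ℕP.≤-pred y<h+1) | ≡ᵇ-false (ℕP.<⇒≢ y<h+1)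
            | <ᵇ-false {suc (suc h)} {y} (ℕP.≤-trans (ℕP.≤-pred y<h+1) (ℕP.≤-trans (ℕP.n≤1+n h) (ℕP.n≤1+n _)))
            | ∧-zeroʳ (suc h <ᵇ K)
      = sym (+-identityʳ _)
    ... | tri≈ _ P.refl _
      rewrite even | <ᵇ-true (ℕP.n<1+n h) | ≡ᵇ-refl h | <ᵇ-false {suc (suc h)} {suc h} (ℕP.n≤1+n _) | ∧-zeroʳ (suc h <ᵇ K)
      = sym (+-identityʳ _)
    ... | tri> _ _ h+1<y with ℕP.<-cmp y (suc (suc h))
    ...   | tri< y<h+2 _ _ = ⊥-elim (ℕP.<⇒≱ h+1<y (ℕP.≤-pred y<h+2))
    ...   | tri≈ _ P.refl _
      rewrite even | <ᵇ-true (ℕP.<-trans (ℕP.n<1+n h) (ℕP.n<1+n _)) | <ᵇ-false {suc (suc h)} {h} (ℕP.≤-trans (ℕP.n≤1+n h) (ℕP.n≤1+n _))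
            | ≡ᵇ-false (ℕP.>⇒≢ (ℕP.n<1+n (suc h))) | <ᵇ-true {suc h} {K} y≤K | <ᵇ-false {suc (suc h)} {suc (suc h)} ℕP.≤-refl
      = sym (+-identityʳ _)
    ...   | tri> _ _ h+2<y
      rewrite even | <ᵇ-true (ℕP.<-trans (ℕP.<-trans (ℕP.n<1+n h) (ℕP.n<1+n _)) h+2<y)
            | <ᵇ-false {y} {h} (ℕP.<⇒≤ (ℕP.<-trans (ℕP.<-trans (ℕP.n<1+n h) (ℕP.n<1+n _)) h+2<y))
            | ≡ᵇ-false (ℕP.>⇒≢ (ℕP.<-trans (ℕP.n<1+n _) h+2<y)) | <ᵇ-true {suc h} {K} (ℕP.<-≤-trans (ℕP.<-trans (ℕP.n<1+n _) h+2<y) y≤K)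
            | <ᵇ-true h+2<y | <ᵇ-false {y} {suc (suc h)} (ℕP.<⇒≤ h+2<y)
      = sym (+-identityˡ _)

  tails-after-odd : ∀ m h → isEven h ≡ true → h ℕ.≤ K → tails (suc m) (suc h) ≈ V h * tails m h + tailsBelow m h
  tails-after-odd m h even h≤K = begin
    Σ< (suc K) (λ y → [ link (suc h) y ]· F y)
      ≈⟨ Σ<-cong (suc K) (λ y _ → link-after-odd h even y (F y)) ⟩
    Σ< (suc K) (λ y → [ y ≡ᵇ h ]· F y + [ linkBelow h y ]· F y)
      ≈⟨ Σ<-+ (suc K) (λ y → [ y ≡ᵇ h ]· F y) (λ y → [ linkBelow h y ]· F y) ⟩
    Σ< (suc K) (λ y → [ y ≡ᵇ h ]· F y) + Σ< (suc K) (λ y → [ linkBelow h y ]· F y)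
      ≈⟨ +-cong (Σ<-δ (suc K) F (s≤s h≤K)) (below h) ⟩
    V h * tails m h + tailsBelow m h ∎
    where
    F : ℕ → Carrier
    F y = V y * tails m y
    below : ∀ h → Σ< (suc K) (λ y → [ linkBelow h y ]· F y) ≈ tailsBelow m h
    below zero = Σ<-zero (suc K)
    below (suc h) = refl

  tails-after-even : ∀ m h → isEven h ≡ true → suc h ℕ.≤ K →
                     tails (suc m) h ≈ V (suc h) * tails m (suc h) + [ suc h <ᵇ K ]· tails (suc m) (suc (suc h))
  tails-after-even m h even h<K = begin
    Σ< (suc K) (λ y → [ link h y ]· F y)
      ≈⟨ Σ<-cong (suc K) (λ y y≤K → link-after-even h even y (F y) (ℕP.≤-pred y≤K)) ⟩
    Σ< (suc K) (λ y → [ y ≡ᵇ suc h ]· F y + [ (suc h <ᵇ K) ∧ link (suc (suc h)) y ]· F y)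
      ≈⟨ Σ<-+ (suc K) (λ y → [ y ≡ᵇ suc h ]· F y) (λ y → [ (suc h <ᵇ K) ∧ link (suc (suc h)) y ]· F y) ⟩
    Σ< (suc K) (λ y → [ y ≡ᵇ suc h ]· F y) + Σ< (suc K) (λ y → [ (suc h <ᵇ K) ∧ link (suc (suc h)) y ]· F y)
      ≈⟨ +-cong (Σ<-δ (suc K) F (s≤s h<K))
                (trans (Σ<-cong (suc K) (λ y _ → []·-∧ (suc h <ᵇ K) (link (suc (suc h)) y) (F y)))
                       (Σ<-[]· (suc K) (suc h <ᵇ K) (λ y → [ link (suc (suc h)) y ]· F y))) ⟩
    V (suc h) * tails m (suc h) + [ suc h <ᵇ K ]· tails (suc m) (suc (suc h)) ∎
    where
    F : ℕ → Carrier
    F y = V y * tails m y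

module NegativeOrbit {c ℓ} (R : CommutativeRing c ℓ)
                     (V Vinv : ℕ → CommutativeRing.Carrier R)
                     (inv : ∀ i → CommutativeRing._≈_ R (CommutativeRing._*_ R (V i) (Vinv i)) (CommutativeRing.1# R))
                     (K : ℕ) (K-odd : isEven K ≡ false) where
  open CommutativeRing R
  open Summation R
  open ℤ-CoefficientSolver R
  open TransferOperator R (lamV R Vinv) K
  open PeakValleyTails R V K
  open import Relation.Binary.Reasoning.Setoid setoid

  scale : ℕ → Carrier
  scale zero = V 0
  scale (suc h) = if isEven h then Vinv h * scale h else - (Vinv h * scale h)

  -- The orbit point at -(m + 1). Rescaling by scale turns the recursions tails-after-odd/even in the
  -- entry into the rows of T, so that T (negativeOrbit (m + 1)) ≈ᴷ negativeOrbit m.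
  negativeOrbit : ℕ → Vector
  negativeOrbit m h = scale h * tails m h

  private
    scale-even : ∀ h → isEven h ≡ true → scale (suc h) ≈ Vinv h * scale h
    scale-even h even rewrite even = refl

    scale-odd : ∀ h → isEven h ≡ false → scale (suc h) ≈ - (Vinv h * scale h)
    scale-odd h odd rewrite odd = refl

    Vinv-V : ∀ i → Vinv i * V i ≈ 1#
    Vinv-V i = trans (*-comm _ _) (inv i)

    even-below-K : ∀ h → isEven h ≡ true → h ℕ.≤ K → (h <ᵇ K) ≡ true
    even-below-K h even h≤K = <ᵇ-true (even≤odd⇒< even K-odd h≤K)

    T-negativeOrbit-at-even : ∀ m h → isEven h ≡ false → suc h ℕ.≤ K →
                              T (negativeOrbit (suc m)) (suc h) ≈ negativeOrbit m (suc h)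
    T-negativeOrbit-at-even m h odd h<K rewrite even-below-K (suc h) (odd-suc h odd) h<K = begin
      scale (suc (suc h)) * tails (suc m) (suc (suc h)) + (Vinv h * Vinv (suc h)) * (scale h * tails (suc m) h)
        ≈⟨ +-cong (*-cong (trans (scale-even (suc h) (odd-suc h odd)) (*-cong refl (scale-odd h odd)))
                          (tails-after-odd m (suc h) (odd-suc h odd) h<K)) refl ⟩
      (Vinv (suc h) * - (Vinv h * scale h)) * (V (suc h) * tails m (suc h) + tails (suc m) h)
        + (Vinv h * Vinv (suc h)) * (scale h * tails (suc m) h)
        ≈⟨ solve 6 (λ a b v s x y → (b :* :- (a :* s)) :* (v :* x :+ y) :+ (a :* b) :* (s :* y)
                                   := (:- (a :* s) :* x) :* (v :* b)) refl
                   (Vinv h) (Vinv (suc h)) (V (suc h)) (scale h) (tails m (suc h)) (tails (suc m) h) ⟩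
      (- (Vinv h * scale h) * tails m (suc h)) * (V (suc h) * Vinv (suc h))
        ≈⟨ trans (*-cong refl (inv (suc h))) (*-identityʳ _) ⟩
      - (Vinv h * scale h) * tails m (suc h)
        ≈⟨ *-cong (sym (scale-odd h odd)) refl ⟩
      scale (suc h) * tails m (suc h) ∎

    T-negativeOrbit-at-odd : ∀ m h → isEven h ≡ true → suc h ℕ.≤ K →
                             T (negativeOrbit (suc m)) (suc h) ≈ negativeOrbit m (suc h)
    T-negativeOrbit-at-odd m h even h<K = begin
      [ b ]· (scale (suc (suc h)) * Z) + (Vinv h * Vinv (suc h)) * (scale h * tails (suc m) h)
        ≈⟨ +-cong ([]·-* b _ Z) (*-cong refl (*-cong refl (tails-after-even m h even h<K))) ⟩
      scale (suc (suc h)) * [ b ]· Z + (Vinv h * Vinv (suc h)) * (scale h * (V (suc h) * tails m (suc h) + [ b ]· Z))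
        ≈⟨ +-cong (*-cong (trans (scale-odd (suc h) (even-suc h even)) (-‿cong (*-cong refl (scale-even h even)))) refl) refl ⟩
      - (Vinv (suc h) * (Vinv h * scale h)) * [ b ]· Z + (Vinv h * Vinv (suc h)) * (scale h * (V (suc h) * tails m (suc h) + [ b ]· Z))
        ≈⟨ solve 6 (λ a b v s x w → (:- (b :* (a :* s))) :* w :+ (a :* b) :* (s :* (v :* x :+ w))
                                   := ((a :* s) :* x) :* (v :* b)) refl
                   (Vinv h) (Vinv (suc h)) (V (suc h)) (scale h) (tails m (suc h)) ([ b ]· Z) ⟩
      ((Vinv h * scale h) * tails m (suc h)) * (V (suc h) * Vinv (suc h))
        ≈⟨ trans (*-cong refl (inv (suc h))) (*-identityʳ _) ⟩
      (Vinv h * scale h) * tails m (suc h)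
        ≈⟨ *-cong (sym (scale-even h even)) refl ⟩
      scale (suc h) * tails m (suc h) ∎
      where
      b : Bool
      b = suc h <ᵇ K
      Z : Carrier
      Z = tails (suc m) (suc (suc h))

  T-negativeOrbit-suc : ∀ m → T (negativeOrbit (suc m)) ≈ᴷ negativeOrbit m
  T-negativeOrbit-suc m zero _ rewrite even-below-K 0 P.refl z≤n = begin
    (Vinv 0 * V 0) * tails (suc m) 1  ≈⟨ *-cong (Vinv-V 0) (tails-after-odd m 0 P.refl z≤n) ⟩
    1# * (V 0 * tails m 0 + 0#)       ≈⟨ trans (*-identityˡ _) (+-identityʳ _) ⟩
    V 0 * tails m 0                   ∎
  T-negativeOrbit-suc m (suc h) h<K with parity h
  ... | inj₁ even = T-negativeOrbit-at-odd m h even h<K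
  ... | inj₂ odd = T-negativeOrbit-at-even m h odd h<K

  T-negativeOrbit-zero : T (negativeOrbit 0) ≈ᴷ δ₀
  T-negativeOrbit-zero zero _ rewrite even-below-K 0 P.refl z≤n = trans (*-identityʳ _) (Vinv-V 0)
  T-negativeOrbit-zero (suc h) h<K with parity h
  ... | inj₂ odd rewrite even-below-K (suc h) (odd-suc h odd) h<K | odd =
    trans (+-cong refl (*-cong refl (*-cong refl ([]·-true 1# (<ᵇ-true (odd⇒positive h odd))))))
          (solve 4 (λ a b s o → (b :* :- (a :* s)) :* o :+ (a :* b) :* (s :* o) := con (+ 0)) refl
                   (Vinv h) (Vinv (suc h)) (scale h) 1#)
  ... | inj₁ even rewrite even =
    trans (+-cong (trans ([]·-* (suc h <ᵇ K) _ 0#) (trans (*-cong refl ([]·-0# (suc h <ᵇ K))) (zeroʳ _))) (*-cong refl (zeroʳ _)))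
          (trans (+-identityˡ _) (zeroʳ _))

  orbit : ℤ → Vector
  orbit (+ n) = T^ n δ₀
  orbit -[1+ m ] = negativeOrbit m

  T-orbit : ∀ z → T (orbit z) ≈ᴷ orbit (z ℤ.+ + 1)
  T-orbit (+ n) h _ = reflexive (P.cong (λ n → T^ n δ₀ h) (ℕP.+-comm 1 n))
  T-orbit -[1+ zero ] = T-negativeOrbit-zero
  T-orbit -[1+ suc m ] = T-negativeOrbit-suc m

module ExtendedMoments {c ℓ} (R : CommutativeRing c ℓ)
                       (V Vinv : ℕ → CommutativeRing.Carrier R)
                       (inv : ∀ i → CommutativeRing._≈_ R (CommutativeRing._*_ R (V i) (Vinv i)) (CommutativeRing.1# R))
                       (K : ℕ) (K-odd : isEven K ≡ false) where
  open CommutativeRing R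
  open Cancellation R using (Unit; Unit-*)
  open LinearRecurrences R
  open TransferOperator R (lamV R Vinv) K
  open PeakValleyTails R V K
  open NegativeOrbit R V Vinv inv K K-odd

  λ-unit : ∀ i → Unit (lamV R Vinv (suc i))
  λ-unit i = Unit-* (V i , trans (*-comm _ _) (inv i)) (V (suc i) , trans (*-comm _ _) (inv (suc i)))

  extension : IsRecExtension R (μ≤ R K (zeroSeq R) (lamV R Vinv)) (λ z → orbit z 0)
  extension = (λ N → sym (μ≤≈T^δ₀ N)) , suc K , s≤s z≤n , charCoeff (suc K) ,
              charCoeff-last-unit λ-unit K-odd , orbit-Recurrent λ-unit K-odd orbit T-orbit (λ _ _ → refl)

  extension-at-negative : ∀ f → IsRecExtension R (μ≤ R K (zeroSeq R) (lamV R Vinv)) f →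
                          ∀ N → f -[1+ suc N ] ≈ V 0 * rsum R (map (seqWt R V) (PV2 K (suc N)))
  extension-at-negative f f-ext N =
    trans (sym (recExtension-unique extension f-ext -[1+ suc N ])) (*-cong refl (sym (peakValleySum N)))

-- Imported only here: at the top, ℕ's _*_ would clash with the ring multiplication opened in the modules.
open import Data.Nat using (_≤_; _*_; _∸_)
open import Data.Integer using () renaming (-_ to ℤneg)

theorem3p5 : ∀ {c ℓ : Level} (R : CommutativeRing c ℓ) →
    let open CommutativeRing R renaming (_*_ to _·_) in
    (V Vinv : ℕ → Carrier) → ((i : ℕ) → V i · Vinv i ≈ 1#) →
    (n k : ℕ) → 1 ≤ n → 1 ≤ k →
    Σ (ℤ → Carrier) (IsRecExtension R (μ≤ R (2 * k ∸ 1) (zeroSeq R) (lamV R Vinv))) ×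
    ((f : ℤ → Carrier) →
      IsRecExtension R (μ≤ R (2 * k ∸ 1) (zeroSeq R) (lamV R Vinv)) f →
      f (ℤneg (+ (2 * n))) ≈ V 0 · rsum R (map (seqWt R V) (PV2 (2 * k ∸ 1) (2 * n ∸ 1))))
theorem3p5 R V Vinv inv (suc n) (suc k) (s≤s z≤n) (s≤s z≤n) =
  (_ , extension) , λ f f-ext →
    P.subst (λ m → f -[1+ m ] ≈ V 0 · rsum R (map (seqWt R V) (PV2 K m)))
            (P.sym (2[1+n]∸1≡1+2n n)) (extension-at-negative f f-ext (n ℕ.+ n))
  where
  open CommutativeRing R renaming (_*_ to _·_)
  K : ℕ
  K = 2 * suc k ∸ 1
  K-odd : isEven K ≡ false
  K-odd = P.trans (P.cong isEven (2[1+n]∸1≡1+2n k)) (P.cong not (isEven-double k))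
  open ExtendedMoments R V Vinv inv K K-odd
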